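{- Let $G$ be a finite connected graph with at least one edge and $\Delta$ any decision tree for $G$. For a subgraph $S$ let $i(S)$ (resp. $\ell(S)$) be the number of edges of $\Delta$-type $\mathbf I$ (resp. $\mathbf L$) for $S$. Then $$T_G(x,y)=\sum_{F\text{ spanning forest of }G}(x-1)^{c(F)-1}y^{\ell(F)}=\sum_{K\text{ connected spanning subgraph of }G}x^{i(K)}(y-1)^{\beta(K)}=\sum_{S\subseteq E(G)}\Big(\frac x2\Big)^{i(S)}\Big(\frac y2\Big)^{\ell(S)}.$$
   Context: Graphs are finite, loops and multiple edges allowed; $m=|E(G)|$. Subgraphs are spanning, identified with edge sets; a spanning forest is an acyclic spanning subgraph; $c(S)$ is the number of connected components of $S$ and $\beta(S)=c(S)+|S|-|V(G)|$. Tutte polynomial: $T_G(x,y)=\sum_{S\subseteq E(G)}(x-1)^{c(S)-c(G)}(y-1)^{\beta(S)}$. An isthmus is an edge whose deletion increases the number of connected components; an edge is standard if neither a loop nor an isthmus. A decision tree for $G$ is a perfect binary tree with all leaves at depth $m-1$ (root at depth $0$), each node labelled by an edge, such that along every root-to-leaf path the labels form a permutation of $E(G)$. Given a subgraph $S$: set $H:=G$, $n:=$ root of $\Delta$; for $k=1,\dots,m$ let $e_k$ be the label of $n$ and do exactly one of: (i) if $e_k$ is standard in $H$ and $e_k\notin S$: type $\mathbf S_e$, $H:=H\setminus e_k$ (deletion), $n:=$ left child; (ii) if $e_k$ is a loop of $H$: type $\mathbf L$, $H:=H\setminus e_k$, $n:=$ left child; (iii) if $e_k$ is standard in $H$ and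 $e_k\in S$: type $\mathbf S_i$, $H:=H/e_k$ (contraction), $n:=$ right child; (iv) if $e_k$ is an isthmus of $H$: type $\mathbf I$, $H:=H/e_k$, $n:=$ right child. -}

module Defs where

open import Data.Bool using (Bool; true; false; _∧_; _∨_; not; if_then_else_)
open import Data.Nat using (ℕ; zero; suc; _+_; _∸_; _≡ᵇ_; _<ᵇ_)
open import Data.Fin using (Fin; toℕ; inject₁; fromℕ) renaming (zero to fzero; suc to fsuc)
open import Data.Fin.Subset using (Subset; _∈_; ⊤)
open import Data.Product using (_×_; _,_; proj₁; proj₂; Σ; Σ-syntax)
open import Data.Sum using (_⊎_)
open import Data.List using (List; []; _∷_; _++_; map; length; filterᵇ; allFin; foldr)
open import Data.Bool.ListAction using (all; any)
open import Data.Vec using (Vec; lookup; _[_]≔_) renaming ([] to v[]; _∷_ to _v∷_)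
open import Data.Rational using (ℚ; 0ℚ; 1ℚ) renaming (_+_ to _+q_; _*_ to _*q_; _-_ to _-q_)
open import Data.List.Relation.Unary.All using (All)
open import Data.List.Relation.Binary.Permutation.Propositional using (_↭_)
open import Relation.Nullary using (¬_)
open import Function.Definitions using (Injective)
open import Relation.Binary.PropositionalEquality using (_≡_)

-- Graphs: n vertices (Fin n), m edges (Fin m), each edge has two
-- endpoints (loops and multiple edges allowed).

record Graph : Set where
  constructor graph
  field
    n    : ℕ
    m    : ℕ
    ends : Fin m → Fin n × Fin n

open Graph public

_==_ : ∀ {k} → Fin k → Fin k → Bool
u == v = toℕ u ≡ᵇ toℕ v

reach : ∀ {n m} → ℕ → (Fin m → Fin n × Fin n) → Subset m → Fin n → Fin n → Bool
reach zero    ends P u v = u == v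
reach (suc k) ends P u v =
  reach k ends P u v ∨
  any (λ e → lookup P e ∧
               ((reach k ends P u (proj₁ (ends e)) ∧ (proj₂ (ends e) == v)) ∨
                (reach k ends P u (proj₂ (ends e)) ∧ (proj₁ (ends e) == v))))
      (allFin _)

-- connectivity in the spanning subgraph with edge set P
-- (walks of length ≤ n suffice)
conn : ∀ {n m} → (Fin m → Fin n × Fin n) → Subset m → Fin n → Fin n → Bool
conn {n} ends P u v = reach n ends P u v

-- number of connected components of the spanning subgraph with edge set
-- P: the number of vertices that are the least vertex of their component
comps : ∀ {n m} → (Fin m → Fin n × Fin n) → Subset m → ℕ
comps {n} ends P =
  length (filterᵇ (λ v → all (λ w → not ((toℕ w <ᵇ toℕ v) ∧ conn ends P w v))
                             (allFin n))
                  (allFin n))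

c : (G : Graph) → Subset (m G) → ℕ
c G S = comps (ends G) S

card : ∀ {m} → Subset m → ℕ
card v[] = 0
card (true v∷ s) = suc (card s)
card (false v∷ s) = card s

-- β(S) = c(S) + |S| - |V(G)|  (always ≥ 0)
β : (G : Graph) → Subset (m G) → ℕ
β G S = (c G S + card S) ∸ n G

allSubsets : (k : ℕ) → List (Subset k)
allSubsets zero = v[] ∷ []
allSubsets (suc k) = map (true v∷_) (allSubsets k) ++ map (false v∷_) (allSubsets k)

_^_ : ℚ → ℕ → ℚ
x ^ zero = 1ℚ
x ^ suc k = x *q (x ^ k)

Σℚ : {A : Set} → List A → (A → ℚ) → ℚ
Σℚ xs f = foldr (λ a r → f a +q r) 0ℚ xs

Tutte : Graph → ℚ → ℚ → ℚ
Tutte G x y =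
  Σℚ (allSubsets (m G)) (λ S →
     ((x -q 1ℚ) ^ (c G S ∸ c G ⊤)) *q ((y -q 1ℚ) ^ β G S))

Connected : Graph → Set
Connected G = c G ⊤ ≡ 1

ConnectedSub : (G : Graph) → Subset (m G) → Set
ConnectedSub G S = c G S ≡ 1

-- Cycles and spanning forests.
-- A cycle of length k ≥ 1 in S: distinct edges es 0..k-1 of S and
-- distinct vertices w 0..k-1, with w k = w 0 and edge es i joining
-- w i and w (i+1).

Joins : (G : Graph) → Fin (m G) → Fin (n G) → Fin (n G) → Set
Joins G e u v = (ends G e ≡ (u , v)) ⊎ (ends G e ≡ (v , u))

record Cycle (G : Graph) (S : Subset (m G)) : Set where
  field
    len   : ℕ
    es    : Fin (suc len) → Fin (m G)
    w     : Fin (suc (suc len)) → Fin (n G)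
    es∈S  : ∀ i → es i ∈ S
    joins : ∀ i → Joins G (es i) (w (inject₁ i)) (w (fsuc i))
    closed : w fzero ≡ w (fromℕ (suc len))
    es-inj : Injective _≡_ _≡_ es
    w-inj  : Injective _≡_ _≡_ (λ i → w (inject₁ i))

Acyclic : (G : Graph) → Subset (m G) → Set
Acyclic G S = ¬ Cycle G S

-- Minors H of G, represented on the same edge labels: an endpoint map
-- and the set of edges still present. Deletion removes an edge;
-- contraction of a non-loop edge (a , b) removes it and identifies b
-- with a (b is left as an isolated vertex, which does not affect
-- loops/isthmuses).

record Minor (G : Graph) : Set where
  constructor minor
  field
    hends   : Fin (m G) → Fin (n G) × Fin (n G)
    present : Subset (m G)

open Minor public

initial : (G : Graph) → Minor G
initial G = minor (ends G) ⊤

delete : ∀ {G} → Minor G → Fin (m G) → Minor G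
delete (minor h p) e = minor h (p [ e ]≔ false)

contract : ∀ {G} → Minor G → Fin (m G) → Minor G
contract (minor h p) e = minor h' (p [ e ]≔ false)
  where
    a = proj₁ (h e)
    b = proj₂ (h e)
    rel = λ v → if v == b then a else v
    h' = λ f → (rel (proj₁ (h f)) , rel (proj₂ (h f)))

isLoop : ∀ {G} → Minor G → Fin (m G) → Bool
isLoop H e = proj₁ (hends H e) == proj₂ (hends H e)

isIsthmus : ∀ {G} → Minor G → Fin (m G) → Bool
isIsthmus H e = comps (hends H) (present H) <ᵇ comps (hends H) (present H [ e ]≔ false)

data EType : Set where
  Se L Si I : EType

-- type of edge e in H with respect to S (e is present in H along any
-- path of a decision tree)
classify : ∀ {G} → Minor G → Subset (m G) → Fin (m G) → EType
classify H S e =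
  if isLoop H e then L
  else if isIsthmus H e then I
  else if lookup S e then Si
  else Se

-- Perfect binary trees with k levels of nodes (leaves at depth k-1).

data PTree (A : Set) : ℕ → Set where
  leaf : A → PTree A 1
  node : ∀ {k} → A → PTree A (suc k) → PTree A (suc k) → PTree A (suc (suc k))

paths : ∀ {A k} → PTree A k → List (List A)
paths (leaf a) = (a ∷ []) ∷ []
paths (node a l r) = map (a ∷_) (paths l ++ paths r)

record DecisionTree (G : Graph) : Set where
  field
    tree  : PTree (Fin (m G)) (m G)
    perms : All
              (λ p → p ↭ allFin (m G))
              (paths tree)

run : ∀ {G k} → PTree (Fin (m G)) k → Minor G → Subset (m G) → List EType
run (leaf e) H S = classify H S e ∷ []
run (node e l r) H S with classify H S e
... | Se = Se ∷ run l (delete H e) S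
... | L  = L  ∷ run l (delete H e) S
... | Si = Si ∷ run r (contract H e) S
... | I  = I  ∷ run r (contract H e) S

isI isL : EType → Bool
isI I = true
isI _ = false
isL L = true
isL _ = false

types : ∀ {G} → DecisionTree G → Subset (m G) → List EType
types {G} Δ S = run (DecisionTree.tree Δ) (initial G) S

iΔ : ∀ {G} → DecisionTree G → Subset (m G) → ℕ
iΔ Δ S = length (filterᵇ isI (types Δ S))

ℓΔ : ∀ {G} → DecisionTree G → Subset (m G) → ℕ
ℓΔ Δ S = length (filterᵇ isL (types Δ S))

module Submission where

open import Defs
open import Data.Nat using (ℕ; _≤_; _∸_; _≡ᵇ_)
open import Data.Product using (_×_)
open import Data.List using (List; filterᵇ)
open import Data.List.Relation.Unary.Unique.Propositional using (Unique)
open import Data.List.Membership.Propositional using () renaming (_∈_ to _∈ₗ_)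
open import Data.Fin.Subset using (Subset)
open import Data.Rational using (ℚ; 1ℚ; ½) renaming (_*_ to _*q_; _-_ to _-q_)
open import Function.Bundles using (_⇔_)
open import Relation.Binary.PropositionalEquality using (_≡_)

-- A decision tree Δ drives a deletion/contraction
-- recursion: at an edge e of the current minor (h , P) (endpoint map h,
-- remaining edges P) the tree either deletes e (loop, or standard edge
-- not in S) or contracts it (isthmus, or standard edge in S).  For a
-- weight W(i , j , types) we consider the sum over ALL S ⊆ E(G) of
-- W evaluated at the corank c(S ∩ P) - c(P), the nullity β(S ∩ P) and the
-- list of Δ-types of S; splitting the sum according to whether e ∈ S
-- (each half weighted by ½) shows that it obeys the recursion
--   loop:  ½·y·(value after deleting e),  isthmus: ½·x·(value after
--   contracting e),  standard: ½·(contracted + deleted value),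
-- provided W satisfies four local identities ("admissible" weights).
-- Two admissible weights therefore give the same sum, by induction on the
-- tree.  The Tutte sum (x-1)^i (y-1)^j and the three weights of the
-- proposition are admissible; rewriting the forest and connected sums as
-- filtered subset sums finishes the proof.

module BoolFacts where

  open import Data.Bool using (Bool; true; false; _∧_; _∨_; not; T)
  open import Data.Nat using (_<_; _<ᵇ_)
  open import Data.Nat.Properties as ℕP using ()
  open import Data.Fin using (Fin; toℕ)
  open import Data.Fin.Properties using (toℕ-injective)
  open import Data.List using ([]; _∷_)
  open import Data.List.Membership.Propositional using (_∈_)
  open import Data.List.Relation.Unary.Any using (here; there)
  open import Data.Bool.ListAction using (all; any)
  open import Data.Product using (Σ; _×_; _,_)
  open import Data.Sum using (_⊎_; inj₁; inj₂)
  open import Data.Empty using (⊥; ⊥-elim)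
  open import Data.Unit using (tt)
  open import Relation.Binary.PropositionalEquality
  open import Relation.Nullary using (¬_)

  ∧-i : ∀ {a b} → a ≡ true → b ≡ true → a ∧ b ≡ true
  ∧-i refl refl = refl

  ∧-l : ∀ {a b} → a ∧ b ≡ true → a ≡ true
  ∧-l {true} _ = refl

  ∧-r : ∀ {a b} → a ∧ b ≡ true → b ≡ true
  ∧-r {true} p = p

  ∨-e : ∀ {a b} → a ∨ b ≡ true → (a ≡ true) ⊎ (b ≡ true)
  ∨-e {true} _ = inj₁ refl
  ∨-e {false} p = inj₂ p

  ∨-il : ∀ {a b} → a ≡ true → a ∨ b ≡ true
  ∨-il refl = refl

  ∨-ir : ∀ {a b} → b ≡ true → a ∨ b ≡ true
  ∨-ir {true} _ = refl
  ∨-ir {false} p = p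

  t≢f : ∀ {a} → a ≡ true → a ≡ false → ⊥
  t≢f refl ()

  not-f : ∀ {a} → not a ≡ true → a ≡ false
  not-f {false} _ = refl

  ¬t⇒f : ∀ {a} → ¬ (a ≡ true) → a ≡ false
  ¬t⇒f {true} p = ⊥-elim (p refl)
  ¬t⇒f {false} _ = refl

  T⇒≡ : ∀ {b} → T b → b ≡ true
  T⇒≡ {true} _ = refl

  ≡⇒T : ∀ {b} → b ≡ true → T b
  ≡⇒T refl = tt

  bool-ext : ∀ {a b} → (a ≡ true → b ≡ true) → (b ≡ true → a ≡ true) → a ≡ b
  bool-ext {true} {true} f g = refl
  bool-ext {true} {false} f g = sym (f refl)
  bool-ext {false} {true} f g = g refl
  bool-ext {false} {false} f g = refl

  ==⇒≡ : ∀ {k} {u v : Fin k} → (u == v) ≡ true → u ≡ v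
  ==⇒≡ {u = u} {v} p = toℕ-injective (ℕP.≡ᵇ⇒≡ (toℕ u) (toℕ v) (≡⇒T p))

  ≡⇒== : ∀ {k} {u v : Fin k} → u ≡ v → (u == v) ≡ true
  ≡⇒== {u = u} refl = T⇒≡ (ℕP.≡⇒≡ᵇ (toℕ u) (toℕ u) refl)

  ==-f : ∀ {k} {u v : Fin k} → ¬ (u ≡ v) → (u == v) ≡ false
  ==-f ne = ¬t⇒f (λ p → ne (==⇒≡ p))

  <ᵇ⇒< : ∀ {a b} → (a <ᵇ b) ≡ true → a < b
  <ᵇ⇒< {a} {b} p = ℕP.<ᵇ⇒< a b (≡⇒T p)

  <⇒<ᵇ : ∀ {a b} → a < b → (a <ᵇ b) ≡ true
  <⇒<ᵇ p = T⇒≡ (ℕP.<⇒<ᵇ p)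

  all-e : ∀ {A : Set} {p : A → Bool} {xs x} → all p xs ≡ true → x ∈ xs → p x ≡ true
  all-e {p = p} {y ∷ ys} h (here refl) = ∧-l {p y} h
  all-e {p = p} {y ∷ ys} h (there m) = all-e (∧-r {p y} h) m

  all-i : ∀ {A : Set} {p : A → Bool} xs → (∀ x → x ∈ xs → p x ≡ true) → all p xs ≡ true
  all-i [] h = refl
  all-i (y ∷ ys) h = ∧-i (h y (here refl)) (all-i ys (λ x m → h x (there m)))

  all-f : ∀ {A : Set} {p : A → Bool} xs → all p xs ≡ false → Σ A λ x → x ∈ xs × p x ≡ false
  all-f [] ()
  all-f {p = p} (y ∷ ys) h with p y in eq
  ... | false = y , here refl , eq
  ... | true with all-f ys h
  ... | x , m , q = x , there m , q

  any-e : ∀ {A : Set} {p : A → Bool} xs → any p xs ≡ true → Σ A λ x → x ∈ xs × p x ≡ true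
  any-e [] ()
  any-e {p = p} (y ∷ ys) h with p y in eq
  ... | true = y , here refl , eq
  ... | false with any-e ys h
  ... | x , m , q = x , there m , q

  any-i : ∀ {A : Set} {p : A → Bool} {xs x} → x ∈ xs → p x ≡ true → any p xs ≡ true
  any-i {p = p} {y ∷ ys} (here refl) q = ∨-il {p y} q
  any-i {p = p} {y ∷ ys} (there m) q = ∨-ir {p y} (any-i m q)
-- Counting the classes of a Bool-valued equivalence relation on Fin n by
-- their least representatives ("roots"); `comps` of Defs is this count
-- for the connectivity relation.

module Representatives where

  open import Data.Bool using (Bool; true; false; _∧_; _∨_; not)
  open import Data.Nat using (ℕ; zero; suc; _≤_; _<_; _<ᵇ_; z≤n; s≤s)
  open import Data.Nat.Properties as ℕP using (≤-refl; ≤-trans; ≤-<-trans; <-irrefl; <-cmp; m≤n⇒m≤1+n)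
  open import Data.Fin using (Fin; toℕ)
  open import Data.Fin.Properties using (toℕ-injective)
  open import Data.List using ([]; _∷_; length; filterᵇ; allFin)
  open import Data.List.Properties using (length-tabulate)
  open import Data.List.Membership.Propositional using (_∈_)
  open import Data.List.Membership.Propositional.Properties using (∈-allFin)
  open import Data.List.Relation.Unary.Any using (here; there)
  open import Data.List.Relation.Unary.All.Properties using (All¬⇒¬Any)
  open import Data.List.Relation.Unary.Unique.Propositional using (Unique; []; _∷_)
  open import Data.List.Relation.Unary.Unique.Propositional.Properties using (allFin⁺)
  open import Data.Bool.ListAction using (all)
  open import Data.Product using (Σ; _×_; _,_)
  open import Data.Sum using (_⊎_; inj₁; inj₂)
  open import Data.Empty using (⊥; ⊥-elim)
  open import Relation.Binary.PropositionalEquality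
  open import Relation.Binary.Definitions using (tri<; tri≈; tri>)
  open import Relation.Nullary using (¬_)
  open import Defs using (_==_)
  open BoolFacts

  filter-ext∈ : ∀ {A : Set} {p q : A → Bool} xs → (∀ x → x ∈ xs → p x ≡ q x) → filterᵇ p xs ≡ filterᵇ q xs
  filter-ext∈ [] h = refl
  filter-ext∈ {p = p} {q} (y ∷ ys) h with p y | q y | h y (here refl)
  ... | true | true | _ = cong (y ∷_) (filter-ext∈ ys (λ x m → h x (there m)))
  ... | false | false | _ = filter-ext∈ ys (λ x m → h x (there m))

  filter-ext : ∀ {A : Set} {p q : A → Bool} xs → (∀ x → p x ≡ q x) → filterᵇ p xs ≡ filterᵇ q xs
  filter-ext xs h = filter-ext∈ xs (λ x _ → h x)

  filter-mono : ∀ {A : Set} {p q : A → Bool} xs → (∀ x → p x ≡ true → q x ≡ true) →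
    length (filterᵇ p xs) ≤ length (filterᵇ q xs)
  filter-mono [] h = z≤n
  filter-mono {p = p} {q} (y ∷ ys) h with p y in ep | q y in eq
  ... | true | true = s≤s (filter-mono ys h)
  ... | true | false = ⊥-elim (t≢f (h y ep) eq)
  ... | false | true = m≤n⇒m≤1+n (filter-mono ys h)
  ... | false | false = filter-mono ys h

  filter-all : ∀ {A : Set} {p : A → Bool} xs → (∀ x → p x ≡ true) → length (filterᵇ p xs) ≡ length xs
  filter-all [] h = refl
  filter-all {p = p} (y ∷ ys) h with p y | h y
  ... | true | _ = cong suc (filter-all ys h)

  ∉-tail : ∀ {A : Set} {y z : A} {ys} → Unique (y ∷ ys) → z ∈ ys → ¬ (y ≡ z)
  ∉-tail (y∉ys ∷ _) m refl = All¬⇒¬Any y∉ys m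

  filter-drop1 : ∀ {k} {p : Fin k → Bool} {z} xs → Unique xs → z ∈ xs → p z ≡ true →
    length (filterᵇ p xs) ≡ suc (length (filterᵇ (λ v → p v ∧ not (v == z)) xs))
  filter-drop1 {p = p} {z} (y ∷ ys) (u ∷ us) (here refl) pz
    rewrite pz | ≡⇒== {u = y} refl =
      cong suc (cong length (filter-ext∈ ys (λ x m → sym (other x m))))
    where
      other : ∀ x → x ∈ ys → (p x ∧ not (x == y)) ≡ p x
      other x m rewrite ==-f {u = x} {v = y} (λ e → ∉-tail (u ∷ us) m (sym e)) with p x
      ... | true = refl
      ... | false = refl
  filter-drop1 {p = p} {z} (y ∷ ys) (u ∷ us) (there m) pz
    rewrite ==-f {u = y} {v = z} (∉-tail (u ∷ us) m) with p y
  ... | true = cong suc (filter-drop1 ys us m pz)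
  ... | false = filter-drop1 ys us m pz

  module _ {n : ℕ} where

    Rel : Set
    Rel = Fin n → Fin n → Bool

    rootB : Rel → Fin n → Bool
    rootB R v = all (λ w → not ((toℕ w <ᵇ toℕ v) ∧ R w v)) (allFin n)

    cnt : Rel → ℕ
    cnt R = length (filterᵇ (rootB R) (allFin n))

    record Eqv (R : Rel) : Set where
      field
        rf : ∀ u → R u u ≡ true
        sy : ∀ {u v} → R u v ≡ true → R v u ≡ true
        tr : ∀ {u v w} → R u v ≡ true → R v w ≡ true → R u w ≡ true

    root-i : ∀ R {v} → (∀ w → toℕ w < toℕ v → R w v ≡ false) → rootB R v ≡ true
    root-i R {v} h = all-i (allFin n) below
      where
        below : ∀ w → w ∈ allFin n → not ((toℕ w <ᵇ toℕ v) ∧ R w v) ≡ true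
        below w _ with toℕ w <ᵇ toℕ v in eq
        ... | false = refl
        ... | true rewrite h w (<ᵇ⇒< eq) = refl

    root-e : ∀ R {v w} → rootB R v ≡ true → toℕ w < toℕ v → R w v ≡ false
    root-e R {v} {w} h lt with all-e {x = w} h (∈-allFin w)
    ... | q rewrite <⇒<ᵇ lt = not-f q

    root-f : ∀ R {v} → rootB R v ≡ false → Σ (Fin n) λ w → toℕ w < toℕ v × R w v ≡ true
    root-f R {v} h with all-f (allFin n) h
    ... | w , _ , q with toℕ w <ᵇ toℕ v in eq | R w v in eR
    ... | true | true = w , <ᵇ⇒< eq , eR
    ... | true | false = ⊥-elim (t≢f refl q)
    ... | false | _ = ⊥-elim (t≢f refl q)

    module _ {R : Rel} (E : Eqv R) where
      open Eqv E

      descend-to-root : ∀ u (k : ℕ) v → toℕ v ≤ k → R v u ≡ true → Σ (Fin n) λ r → R r u ≡ true × rootB R r ≡ true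
      descend-to-root u k v le Rvu with rootB R v in er
      ... | true = v , Rvu , er
      ... | false with root-f R er
      descend-to-root u zero v le Rvu | false | w , lt , _ = ⊥-elim (ℕP.n≮0 (≤-trans lt le))
      descend-to-root u (suc k) v le Rvu | false | w , lt , Rwv =
        descend-to-root u k w (ℕP.≤-pred (≤-trans lt le)) (tr Rwv Rvu)

      findRoot : ∀ u → Σ (Fin n) λ r → R r u ≡ true × rootB R r ≡ true
      findRoot u = descend-to-root u (toℕ u) u ≤-refl (rf u)

      root-unique : ∀ {r1 r2} → rootB R r1 ≡ true → rootB R r2 ≡ true → R r1 r2 ≡ true → r1 ≡ r2
      root-unique {r1} {r2} h1 h2 R12 with <-cmp (toℕ r1) (toℕ r2)
      ... | tri< lt _ _ = ⊥-elim (t≢f R12 (root-e R h2 lt))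
      ... | tri≈ _ eq _ = toℕ-injective eq
      ... | tri> _ _ gt = ⊥-elim (t≢f (sy R12) (root-e R h1 gt))

      root-min : ∀ {r w} → rootB R r ≡ true → R w r ≡ true → toℕ r ≤ toℕ w
      root-min {r} {w} h Rwr with ℕP.<-≤-connex (toℕ w) (toℕ r)
      ... | inj₁ lt = ⊥-elim (t≢f Rwr (root-e R h lt))
      ... | inj₂ le = le

    all-ext : ∀ {A : Set} {p q : A → Bool} xs → (∀ x → p x ≡ q x) → all p xs ≡ all q xs
    all-ext [] h = refl
    all-ext (y ∷ ys) h = cong₂ _∧_ (h y) (all-ext ys h)

    root-ext : ∀ {R R'} → (∀ u v → R u v ≡ R' u v) → ∀ v → rootB R v ≡ rootB R' v
    root-ext h v = all-ext (allFin n) (λ w → cong (λ b → not ((toℕ w <ᵇ toℕ v) ∧ b)) (h w v))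

    cnt-ext : ∀ {R R'} → (∀ u v → R u v ≡ R' u v) → cnt R ≡ cnt R'
    cnt-ext h = cong length (filter-ext (allFin n) (root-ext h))

    cnt-mono : ∀ {R R'} → (∀ u v → R u v ≡ true → R' u v ≡ true) → cnt R' ≤ cnt R
    cnt-mono {R} {R'} h = filter-mono (allFin n) λ v r' → root-i R λ w lt →
      ¬t⇒f (λ Rwv → t≢f (h w v Rwv) (root-e R' r' lt))

    cnt-id : ∀ {R} → (∀ u v → R u v ≡ true → u ≡ v) → cnt R ≡ n
    cnt-id {R} h = trans (filter-all (allFin n) (λ v → root-i R λ w lt →
        ¬t⇒f (λ Rwv → <-irrefl (cong toℕ (h w v Rwv)) lt)))
      (length-tabulate (λ x → x))

    merge : Rel → Fin n → Fin n → Rel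
    merge R a b u v = R u v ∨ (R u a ∧ R b v) ∨ (R u b ∧ R a v)

    merge-⊇ : ∀ R a b {u v} → R u v ≡ true → merge R a b u v ≡ true
    merge-⊇ R a b p = ∨-il p

    merge-e : ∀ R a b {u v} → merge R a b u v ≡ true →
      (R u v ≡ true) ⊎ ((R u a ≡ true × R b v ≡ true) ⊎ (R u b ≡ true × R a v ≡ true))
    merge-e R a b {u} {v} p with ∨-e {R u v} p
    ... | inj₁ q = inj₁ q
    ... | inj₂ q with ∨-e {R u a ∧ R b v} q
    ... | inj₁ r = inj₂ (inj₁ (∧-l r , ∧-r {R u a} r))
    ... | inj₂ r = inj₂ (inj₂ (∧-l r , ∧-r {R u b} r))

    merge-i1 : ∀ R a b {u v} → R u a ≡ true → R b v ≡ true → merge R a b u v ≡ true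
    merge-i1 R a b {u} {v} p q = ∨-ir {R u v} (∨-il (∧-i p q))

    merge-i2 : ∀ R a b {u v} → R u b ≡ true → R a v ≡ true → merge R a b u v ≡ true
    merge-i2 R a b {u} {v} p q = ∨-ir {R u v} (∨-ir {R u a ∧ R b v} (∧-i p q))

    merge-eqv : ∀ {R} → Eqv R → ∀ a b → Eqv (merge R a b)
    merge-eqv {R} E a b = record { rf = λ u → merge-⊇ R a b (rf u) ; sy = sy' ; tr = tr' }
      where
        open Eqv E
        sy' : ∀ {u v} → merge R a b u v ≡ true → merge R a b v u ≡ true
        sy' p with merge-e R a b p
        ... | inj₁ q = merge-⊇ R a b (sy q)
        ... | inj₂ (inj₁ (q , r)) = merge-i2 R a b (sy r) (sy q)
        ... | inj₂ (inj₂ (q , r)) = merge-i1 R a b (sy r) (sy q)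
        tr' : ∀ {u v w} → merge R a b u v ≡ true → merge R a b v w ≡ true → merge R a b u w ≡ true
        tr' p p' with merge-e R a b p | merge-e R a b p'
        ... | inj₁ q | inj₁ q' = merge-⊇ R a b (tr q q')
        ... | inj₁ q | inj₂ (inj₁ (q' , r')) = merge-i1 R a b (tr q q') r'
        ... | inj₁ q | inj₂ (inj₂ (q' , r')) = merge-i2 R a b (tr q q') r'
        ... | inj₂ (inj₁ (q , r)) | inj₁ q' = merge-i1 R a b q (tr r q')
        ... | inj₂ (inj₁ (q , r)) | inj₂ (inj₁ (q' , r')) = merge-i1 R a b q r'
        ... | inj₂ (inj₁ (q , r)) | inj₂ (inj₂ (q' , r')) = merge-⊇ R a b (tr q r')
        ... | inj₂ (inj₂ (q , r)) | inj₁ q' = merge-i2 R a b q (tr r q')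
        ... | inj₂ (inj₂ (q , r)) | inj₂ (inj₁ (q' , r')) = merge-⊇ R a b (tr q r')
        ... | inj₂ (inj₂ (q , r)) | inj₂ (inj₂ (q' , r')) = merge-i2 R a b q r'

    module _ {R : Rel} (E : Eqv R) where
      open Eqv E

      private
        merged-roots : ∀ {a b ra rb} → R ra a ≡ true → R rb b ≡ true → rootB R ra ≡ true → rootB R rb ≡ true →
          toℕ ra < toℕ rb → ∀ v → rootB (merge R a b) v ≡ (rootB R v ∧ not (v == rb))
        merged-roots {a} {b} {ra} {rb} Ra Rb rta rtb lt v = bool-ext to from
          where
            R' : Rel
            R' = merge R a b
            to : rootB R' v ≡ true → (rootB R v ∧ not (v == rb)) ≡ true
            to h' with v == rb in eq
            ... | false = ∧-i (root-i R (λ w lt' → ¬t⇒f (λ Rwv → t≢f (merge-⊇ R a b Rwv) (root-e R' h' lt')))) refl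
            ... | true with ==⇒≡ {u = v} eq
            ... | refl = ⊥-elim (t≢f (merge-i1 R a b Ra (sy Rb)) (root-e R' h' lt))
            from : (rootB R v ∧ not (v == rb)) ≡ true → rootB R' v ≡ true
            from h = root-i R' λ w lt' → ¬t⇒f λ R'wv → unrelated w lt' R'wv
              where
                v-root : rootB R v ≡ true
                v-root = ∧-l h
                v≢rb : not (v == rb) ≡ true
                v≢rb = ∧-r {rootB R v} h
                unrelated : ∀ w → toℕ w < toℕ v → R' w v ≡ true → ⊥
                unrelated w lt' R'wv with merge-e R a b R'wv
                ... | inj₁ Rwv = t≢f Rwv (root-e R v-root lt')
                ... | inj₂ (inj₁ (Rwa , Rbv)) =
                  t≢f (≡⇒== {u = v} (sym (root-unique E rtb v-root (tr Rb Rbv)))) (not-f v≢rb)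
                ... | inj₂ (inj₂ (Rwb , Rav)) =
                  let v≡ra = sym (root-unique E rta v-root (tr Ra Rav))
                      le = root-min E rtb (tr Rwb (sy Rb))
                  in <-irrefl refl (≤-<-trans le (≤-<-trans (ℕP.<⇒≤ lt') (subst (λ z → toℕ z < toℕ rb) (sym v≡ra) lt)))

      cnt-merge-lt : ∀ {a b ra rb} → R ra a ≡ true → R rb b ≡ true → rootB R ra ≡ true → rootB R rb ≡ true →
          toℕ ra < toℕ rb → suc (cnt (merge R a b)) ≡ cnt R
      cnt-merge-lt {a} {b} {ra} {rb} Ra Rb rta rtb lt =
        trans (cong suc (cong length (filter-ext (allFin n) (merged-roots Ra Rb rta rtb lt))))
              (sym (filter-drop1 (allFin n) (allFin⁺ n) (∈-allFin rb) rtb))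

    merge-swap : ∀ R a b u v → merge R a b u v ≡ merge R b a u v
    merge-swap R a b u v with R u v | R u a ∧ R b v | R u b ∧ R a v
    ... | true | _ | _ = refl
    ... | false | true | true = refl
    ... | false | true | false = refl
    ... | false | false | true = refl
    ... | false | false | false = refl

    cnt-merge : ∀ {R} → Eqv R → ∀ a b → R a b ≡ false → suc (cnt (merge R a b)) ≡ cnt R
    cnt-merge {R} E a b Rab with findRoot E a | findRoot E b
    ... | ra , Ra , rta | rb , Rb , rtb with <-cmp (toℕ ra) (toℕ rb)
    ... | tri< lt _ _ = cnt-merge-lt E Ra Rb rta rtb lt
    ... | tri≈ _ eq _ = ⊥-elim (t≢f (Eqv.tr E (Eqv.sy E Ra) (subst (λ z → R z b ≡ true) (sym (toℕ-injective eq)) Rb)) Rab)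
    ... | tri> _ _ gt = trans (cong suc (cnt-ext (merge-swap R a b))) (cnt-merge-lt E Rb Ra rtb rta gt)

-- Walks in the spanning subgraph (h , X): `reach`/`conn` of Defs hold
-- exactly when a walk exists, so `conn h X` is an equivalence relation.
-- Loop erasure makes walks vertex-injective (hence of length < n), which
-- is also how cycles are extracted in the module Forests.

module Walks where

  open import Data.Bool using (Bool; true; _∧_; _∨_)
  open import Data.Nat using (ℕ; zero; suc; _+_; _≤_; _<_)
  open import Data.Nat.Properties as ℕP using ()
  open import Data.Fin using (Fin; inject₁; fromℕ) renaming (zero to fzero; suc to fsuc)
  open import Data.Fin.Properties using (injective⇒≤) renaming (_≟_ to _≟F_)
  open import Data.Fin.Subset using (Subset)
  open import Data.Vec using (lookup)
  open import Data.List using (List; []; _∷_; allFin)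
  open import Data.List.Membership.Propositional using (_∈_)
  open import Data.List.Membership.Propositional.Properties using (∈-allFin)
  import Data.List.Membership.DecPropositional as DecMembership
  open import Data.List.Relation.Unary.Any using (here; there)
  open import Data.List.Relation.Unary.All.Properties using (¬Any⇒All¬; All¬⇒¬Any)
  open import Data.List.Relation.Unary.Unique.Propositional using (Unique; []; _∷_)
  open import Data.List.Relation.Unary.All using ([])
  open import Data.Product using (Σ; _×_; _,_; proj₁; proj₂)
  open import Data.Sum using (_⊎_; inj₁; inj₂)
  open import Data.Empty using (⊥-elim)
  open import Relation.Binary.PropositionalEquality
  open import Relation.Nullary using (yes; no)
  open import Function.Definitions using (Injective)
  open import Defs using (_==_; reach; conn)
  open BoolFacts
  open Representatives using (Eqv)

  module _ {n m : ℕ} (h : Fin m → Fin n × Fin n) where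

    Step : Subset m → Fin n → Fin n → Set
    Step X x y = Σ (Fin m) λ f → lookup X f ≡ true × (h f ≡ (x , y) ⊎ h f ≡ (y , x))

    data Walk (X : Subset m) : Fin n → Fin n → ℕ → Set where
      wnil : ∀ {u} → Walk X u u 0
      wcons : ∀ {u x v k} → Step X u x → Walk X x v k → Walk X u v (suc k)

    module _ {X : Subset m} where

      step-sym : ∀ {x y} → Step X x y → Step X y x
      step-sym (f , l , inj₁ p) = f , l , inj₂ p
      step-sym (f , l , inj₂ p) = f , l , inj₁ p

      wsnoc : ∀ {u x y k} → Walk X u x k → Step X x y → Walk X u y (suc k)
      wsnoc wnil s = wcons s wnil
      wsnoc (wcons s' w) s = wcons s' (wsnoc w s)

      wrev : ∀ {u v k} → Walk X u v k → Walk X v u k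
      wrev wnil = wnil
      wrev (wcons s w) = wsnoc (wrev w) (step-sym s)

      wapp : ∀ {u x v j k} → Walk X u x j → Walk X x v k → Walk X u v (j + k)
      wapp wnil w = w
      wapp (wcons s w) w' = wcons s (wapp w w')

      verts : ∀ {u v k} → Walk X u v k → List (Fin n)
      verts (wnil {u}) = u ∷ []
      verts (wcons {u} s w) = u ∷ verts w

      suffix : ∀ {x v j u} (w : Walk X x v j) → u ∈ verts w →
        Σ ℕ λ j' → Σ (Walk X u v j') λ w' → (Unique (verts w) → Unique (verts w'))
      suffix wnil (here refl) = _ , wnil , λ q → q
      suffix (wcons s w) (here refl) = _ , wcons s w , λ q → q
      suffix (wcons s w) (there u∈w) with suffix w u∈w
      ... | j' , w' , keeps = j' , w' , λ { (_ ∷ q) → keeps q }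

      loop-erase : ∀ {u v k} → Walk X u v k → Σ ℕ λ j → Σ (Walk X u v j) λ w → Unique (verts w)
      loop-erase wnil = 0 , wnil , [] ∷ []
      loop-erase (wcons {u} s w) with loop-erase w
      ... | j , w' , uq with DecMembership._∈?_ _≟F_ u (verts w')
      ... | yes u∈w' with suffix w' u∈w'
      ... | j' , w'' , keeps = j' , w'' , keeps uq
      loop-erase (wcons {u} s w) | j , w' , uq | no u∉w' = suc j , wcons s w' , ¬Any⇒All¬ (verts w') u∉w' ∷ uq

      vs : ∀ {u v k} → Walk X u v k → Fin (suc k) → Fin n
      vs (wnil {u}) fzero = u
      vs (wcons {u} s w) fzero = u
      vs (wcons s w) (fsuc i) = vs w i

      es : ∀ {u v k} → Walk X u v k → Fin k → Fin m
      es (wcons s w) fzero = proj₁ s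
      es (wcons s w) (fsuc i) = es w i

      vs-mem : ∀ {u v k} (w : Walk X u v k) i → vs w i ∈ verts w
      vs-mem wnil fzero = here refl
      vs-mem (wcons s w) fzero = here refl
      vs-mem (wcons s w) (fsuc i) = there (vs-mem w i)

      vs-inj : ∀ {u v k} (w : Walk X u v k) → Unique (verts w) → Injective _≡_ _≡_ (vs w)
      vs-inj wnil _ {fzero} {fzero} _ = refl
      vs-inj (wcons s w) _ {fzero} {fzero} _ = refl
      vs-inj (wcons s w) (u∉w ∷ _) {fzero} {fsuc j} e = ⊥-elim (All¬⇒¬Any u∉w (subst (_∈ verts w) (sym e) (vs-mem w j)))
      vs-inj (wcons s w) (u∉w ∷ _) {fsuc i} {fzero} e = ⊥-elim (All¬⇒¬Any u∉w (subst (_∈ verts w) e (vs-mem w i)))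
      vs-inj (wcons s w) (_ ∷ q) {fsuc i} {fsuc j} e = cong fsuc (vs-inj w q e)

      vs-first : ∀ {u v k} (w : Walk X u v k) → vs w fzero ≡ u
      vs-first wnil = refl
      vs-first (wcons s w) = refl

      vs-last : ∀ {u v k} (w : Walk X u v k) → vs w (fromℕ k) ≡ v
      vs-last wnil = refl
      vs-last (wcons s w) = vs-last w

      es-step : ∀ {u v k} (w : Walk X u v k) i → lookup X (es w i) ≡ true ×
        (h (es w i) ≡ (vs w (inject₁ i) , vs w (fsuc i)) ⊎ h (es w i) ≡ (vs w (fsuc i) , vs w (inject₁ i)))
      es-step (wcons (f , l , p) wnil) fzero = l , p
      es-step (wcons (f , l , p) (wcons _ _)) fzero = l , p
      es-step (wcons s w) (fsuc i) = es-step w i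

      shorten : ∀ {u v k} → Walk X u v k → Σ ℕ λ j → j < n × Walk X u v j
      shorten w with loop-erase w
      ... | j , w' , uq = j , injective⇒≤ (vs-inj w' uq) , w'

    reach-suc : ∀ {X} k u v → reach k h X u v ≡ true → reach (suc k) h X u v ≡ true
    reach-suc k u v p = ∨-il p

    reach-mono : ∀ {X} j k u v → j ≤ k → reach j h X u v ≡ true → reach k h X u v ≡ true
    reach-mono {X} j k u v le p with ℕP.m≤n⇒∃[o]m+o≡n le
    ... | o , refl = longer j o p
      where
        longer : ∀ j o → reach j h X u v ≡ true → reach (j + o) h X u v ≡ true
        longer j zero p rewrite ℕP.+-identityʳ j = p
        longer j (suc o) p rewrite ℕP.+-suc j o = reach-suc (j + o) u v (longer j o p)

    lastEdge : Subset m → ℕ → Fin n → Fin n → Fin m → Bool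
    lastEdge X k u v f = (reach k h X u (proj₁ (h f)) ∧ (proj₂ (h f) == v)) ∨ (reach k h X u (proj₂ (h f)) ∧ (proj₁ (h f) == v))

    reach-cons : ∀ {X} j {u x v} → Step X u x → reach j h X x v ≡ true → reach (suc j) h X u v ≡ true
    reach-cons {X} zero {u} {x} {v} (f , l , p) r with ==⇒≡ {u = x} r
    ... | refl = ∨-ir {reach 0 h X u x} (any-i (∈-allFin f) (∧-i l (last-edge p)))
      where
        last-edge : (h f ≡ (u , x) ⊎ h f ≡ (x , u)) → lastEdge X 0 u x f ≡ true
        last-edge (inj₁ e) rewrite e = ∨-il (∧-i (≡⇒== {u = u} refl) (≡⇒== {u = x} refl))
        last-edge (inj₂ e) rewrite e = ∨-ir {reach 0 h X u x ∧ (u == x)} (∧-i (≡⇒== {u = u} refl) (≡⇒== {u = x} refl))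
    reach-cons {X} (suc j) {u} {x} {v} s r with ∨-e {reach j h X x v} r
    ... | inj₁ r' = reach-suc (suc j) u v (reach-cons j s r')
    ... | inj₂ r' with any-e (allFin _) r'
    ... | f , _ , q = ∨-ir {reach (suc j) h X u v} (any-i (∈-allFin f) (∧-i (∧-l q) (last-edge (∧-r {lookup X f} q))))
      where
        last-edge : lastEdge X j x v f ≡ true → lastEdge X (suc j) u v f ≡ true
        last-edge t with ∨-e {reach j h X x (proj₁ (h f)) ∧ (proj₂ (h f) == v)} t
        ... | inj₁ t₁ = ∨-il (∧-i (reach-cons j s (∧-l t₁)) (∧-r {reach j h X x (proj₁ (h f))} t₁))
        ... | inj₂ t₂ = ∨-ir {reach (suc j) h X u (proj₁ (h f)) ∧ (proj₂ (h f) == v)}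
                          (∧-i (reach-cons j s (∧-l t₂)) (∧-r {reach j h X x (proj₂ (h f))} t₂))

    walk-reach : ∀ {X u v k} → Walk X u v k → reach k h X u v ≡ true
    walk-reach (wnil {u}) = ≡⇒== {u = u} refl
    walk-reach (wcons {k = k} s w) = reach-cons k s (walk-reach w)

    reach-walk : ∀ {X} k u v → reach k h X u v ≡ true → Σ ℕ λ j → Walk X u v j
    reach-walk zero u v r with ==⇒≡ {u = u} r
    ... | refl = 0 , wnil
    reach-walk {X} (suc k) u v r with ∨-e {reach k h X u v} r
    ... | inj₁ r' = reach-walk k u v r'
    ... | inj₂ r' with any-e (allFin _) r'
    ... | f , _ , q with ∨-e {reach k h X u (proj₁ (h f)) ∧ (proj₂ (h f) == v)} (∧-r {lookup X f} q)
    ... | inj₁ t with reach-walk k u (proj₁ (h f)) (∧-l t) | ==⇒≡ {u = proj₂ (h f)} (∧-r {reach k h X u (proj₁ (h f))} t)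
    ... | j , w | refl = suc j , wsnoc w (f , ∧-l q , inj₁ refl)
    reach-walk {X} (suc k) u v r | inj₂ r' | f , _ , q | inj₂ t
      with reach-walk k u (proj₂ (h f)) (∧-l t) | ==⇒≡ {u = proj₁ (h f)} (∧-r {reach k h X u (proj₂ (h f))} t)
    ... | j , w | refl = suc j , wsnoc w (f , ∧-l q , inj₂ refl)

    conn⇒walk : ∀ {X u v} → conn h X u v ≡ true → Σ ℕ λ j → Walk X u v j
    conn⇒walk {X} {u} {v} r = reach-walk n u v r

    walk⇒conn : ∀ {X u v k} → Walk X u v k → conn h X u v ≡ true
    walk⇒conn {X} {u} {v} w with shorten w
    ... | j , lt , w' = reach-mono j n u v (ℕP.<⇒≤ lt) (walk-reach w')

    conn-eqv : ∀ X → Eqv (conn h X)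
    conn-eqv X = record
      { rf = λ u → walk⇒conn (wnil {X = X} {u = u})
      ; sy = λ p → walk⇒conn (wrev (proj₂ (conn⇒walk p)))
      ; tr = λ p q → walk⇒conn (wapp (proj₂ (conn⇒walk p)) (proj₂ (conn⇒walk q))) }

module Components where

  open import Data.Bool using (Bool; true; false; if_then_else_)
  open import Data.Nat using (ℕ; zero; suc; _+_; _≤_)
  open import Data.Nat.Properties as ℕP using (≤-trans)
  open import Data.Fin using (Fin) renaming (zero to fzero; suc to fsuc)
  open import Data.Fin.Properties using () renaming (_≟_ to _≟F_)
  open import Data.Fin.Subset using (Subset)
  open import Data.Vec using (lookup; _[_]≔_) renaming (_∷_ to _v∷_)
  open import Data.Vec.Properties using (lookup∘update; lookup∘update′; []≔-idempotent; []≔-lookup)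
  open import Data.Product using (Σ; _×_; _,_; proj₁; proj₂)
  open import Data.Sum using (_⊎_; inj₁; inj₂)
  open import Data.Empty using (⊥-elim)
  open import Relation.Binary.PropositionalEquality
  open import Relation.Nullary using (¬_; yes; no)
  open import Defs using (_==_; conn; comps; card)
  open BoolFacts
  open Representatives
  open Walks

  _⊆s_ : ∀ {m} → Subset m → Subset m → Set
  X ⊆s Y = ∀ f → lookup X f ≡ true → lookup Y f ≡ true

  upd-same : ∀ {m} (X : Subset m) e b → lookup (X [ e ]≔ b) e ≡ b
  upd-same X e b = lookup∘update e X b

  upd-other : ∀ {m} (X : Subset m) {e f} b → ¬ (f ≡ e) → lookup (X [ e ]≔ b) f ≡ lookup X f
  upd-other X b ne = lookup∘update′ ne X b

  upd-noop : ∀ {m} (X : Subset m) e {b} → lookup X e ≡ b → X [ e ]≔ b ≡ X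
  upd-noop X e p = subst (λ z → X [ e ]≔ z ≡ X) p ([]≔-lookup X e)

  upd-restore : ∀ {m} (X : Subset m) e → lookup X e ≡ true → (X [ e ]≔ false) [ e ]≔ true ≡ X
  upd-restore X e p = trans ([]≔-idempotent X e) (upd-noop X e p)

  removed-⊆ : ∀ {m} (X : Subset m) e → (X [ e ]≔ false) ⊆s X
  removed-⊆ X e f l with f ≟F e
  ... | yes refl = ⊥-elim (t≢f l (upd-same X e false))
  ... | no ne = trans (sym (upd-other X false ne)) l

  module OnEnds {n m : ℕ} (h : Fin m → Fin n × Fin n) where

    walk-mono : ∀ {X Y u v k} → X ⊆s Y → Walk h X u v k → Walk h Y u v k
    walk-mono X⊆Y wnil = wnil
    walk-mono X⊆Y (wcons (f , l , p) w) = wcons (f , X⊆Y f l , p) (walk-mono X⊆Y w)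

    conn-mono : ∀ {X Y u v} → X ⊆s Y → conn h X u v ≡ true → conn h Y u v ≡ true
    conn-mono X⊆Y p = walk⇒conn h (walk-mono X⊆Y (proj₂ (conn⇒walk h p)))

    comps-anti : ∀ {X Y} → X ⊆s Y → comps h Y ≤ comps h X
    comps-anti {X} {Y} X⊆Y = cnt-mono {R = conn h X} {R' = conn h Y} (λ u v → conn-mono {X} {Y} {u} {v} X⊆Y)

    edge-conn : ∀ {X u v} → Step h X u v → conn h X u v ≡ true
    edge-conn s = walk⇒conn h (wcons s wnil)

    comps-empty : ∀ {X} → (∀ f → lookup X f ≡ false) → comps h X ≡ n
    comps-empty {X} none = cnt-id {R = conn h X} (λ u v p → trivial (proj₂ (conn⇒walk h p)))
      where
        trivial : ∀ {u v k} → Walk h X u v k → u ≡ v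
        trivial wnil = refl
        trivial (wcons (f , l , _) w) = ⊥-elim (t≢f l (none f))

    module AtEdge (e : Fin m) where
      a b : Fin n
      a = proj₁ (h e)
      b = proj₂ (h e)

      conn-add : ∀ X u v → conn h (X [ e ]≔ true) u v ≡ merge (conn h X) a b u v
      conn-add X u v = bool-ext to from
        where
          X⁺ : Subset m
          X⁺ = X [ e ]≔ true
          R : Fin n → Fin n → Bool
          R = conn h X
          merged : Eqv (merge R a b)
          merged = merge-eqv (conn-eqv h X) a b
          X⊆X⁺ : X ⊆s X⁺
          X⊆X⁺ f l with f ≟F e
          ... | yes refl = upd-same X e true
          ... | no ne = trans (upd-other X true ne) l
          walk⇒merged : ∀ {u v k} → Walk h X⁺ u v k → merge R a b u v ≡ true
          walk⇒merged wnil = merge-⊇ R a b (Eqv.rf (conn-eqv h X) _)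
          walk⇒merged {u} (wcons {x = x} (f , l , p) w) = Eqv.tr merged (step⇒merged p) (walk⇒merged w)
            where
              step⇒merged : (h f ≡ (u , x) ⊎ h f ≡ (x , u)) → merge R a b u x ≡ true
              step⇒merged p with f ≟F e
              step⇒merged (inj₁ q) | yes refl =
                merge-i1 R a b (subst (λ z → R u z ≡ true) (sym (cong proj₁ q)) (Eqv.rf (conn-eqv h X) u))
                               (subst (λ z → R z x ≡ true) (sym (cong proj₂ q)) (Eqv.rf (conn-eqv h X) x))
              step⇒merged (inj₂ q) | yes refl =
                merge-i2 R a b (subst (λ z → R u z ≡ true) (sym (cong proj₂ q)) (Eqv.rf (conn-eqv h X) u))
                               (subst (λ z → R z x ≡ true) (sym (cong proj₁ q)) (Eqv.rf (conn-eqv h X) x))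
              step⇒merged p | no ne = merge-⊇ R a b (edge-conn (f , trans (sym (upd-other X true ne)) l , p))
          a~b : conn h X⁺ a b ≡ true
          a~b = edge-conn (e , upd-same X e true , inj₁ refl)
          to : conn h X⁺ u v ≡ true → merge R a b u v ≡ true
          to p = walk⇒merged (proj₂ (conn⇒walk h p))
          E⁺ : Eqv (conn h X⁺)
          E⁺ = conn-eqv h X⁺
          from : merge R a b u v ≡ true → conn h X⁺ u v ≡ true
          from p with merge-e R a b p
          ... | inj₁ q = conn-mono X⊆X⁺ q
          ... | inj₂ (inj₁ (q , r)) = Eqv.tr E⁺ (conn-mono X⊆X⁺ q) (Eqv.tr E⁺ a~b (conn-mono X⊆X⁺ r))
          ... | inj₂ (inj₂ (q , r)) = Eqv.tr E⁺ (conn-mono X⊆X⁺ q) (Eqv.tr E⁺ (Eqv.sy E⁺ a~b) (conn-mono X⊆X⁺ r))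

      add-joined : ∀ X → conn h X a b ≡ true → comps h (X [ e ]≔ true) ≡ comps h X
      add-joined X a~b = cnt-ext {R = conn h (X [ e ]≔ true)} {R' = conn h X} λ u v →
        trans (conn-add X u v) (bool-ext unmerge (merge-⊇ (conn h X) a b))
        where
          E : Eqv (conn h X)
          E = conn-eqv h X
          unmerge : ∀ {u v} → merge (conn h X) a b u v ≡ true → conn h X u v ≡ true
          unmerge p with merge-e (conn h X) a b p
          ... | inj₁ q = q
          ... | inj₂ (inj₁ (q , r)) = Eqv.tr E q (Eqv.tr E a~b r)
          ... | inj₂ (inj₂ (q , r)) = Eqv.tr E q (Eqv.tr E (Eqv.sy E a~b) r)

      add-separating : ∀ X → conn h X a b ≡ false → suc (comps h (X [ e ]≔ true)) ≡ comps h X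
      add-separating X a≁b =
        trans (cong suc (cnt-ext {R = conn h (X [ e ]≔ true)} {R' = merge (conn h X) a b} (conn-add X)))
              (cnt-merge (conn-eqv h X) a b a≁b)

      add-≤ : ∀ X → comps h X ≤ suc (comps h (X [ e ]≔ true))
      add-≤ X with conn h X a b in joined
      ... | true = ℕP.m≤n⇒m≤1+n (ℕP.≤-reflexive (sym (add-joined X joined)))
      ... | false = ℕP.≤-reflexive (sym (add-separating X joined))

      identify : Fin n → Fin n
      identify v = if v == b then a else v

      contracted : Fin m → Fin n × Fin n
      contracted f = (identify (proj₁ (h f)) , identify (proj₂ (h f)))

      -- for a non-loop e, connectivity of X + e is the contracted
      -- connectivity of X - e with the (now isolated) vertex b merged into a
      module Contraction (a≢b : ¬ (a ≡ b)) (X : Subset m) where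
        X⁺ X⁻ : Subset m
        X⁺ = X [ e ]≔ true
        X⁻ = X [ e ]≔ false

        before after : Fin n → Fin n → Bool
        before = conn h X⁺
        after = conn contracted X⁻

        E⁺ : Eqv before
        E⁺ = conn-eqv h X⁺
        E⁻ : Eqv after
        E⁻ = conn-eqv contracted X⁻
        merged : Eqv (merge after a b)
        merged = merge-eqv E⁻ a b

        identify≢b : ∀ z → ¬ (identify z ≡ b)
        identify≢b z with z == b in eq
        ... | true = a≢b
        ... | false = λ q → t≢f (≡⇒== q) eq

        identify-merged : ∀ z → merge after a b z (identify z) ≡ true
        identify-merged z with z == b in eq
        ... | true = subst (λ w → merge after a b w a ≡ true) (sym (==⇒≡ eq))
                       (merge-i2 after a b (Eqv.rf E⁻ b) (Eqv.rf E⁻ a))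
        ... | false = Eqv.rf merged z

        a~b : before a b ≡ true
        a~b = edge-conn (e , upd-same X e true , inj₁ refl)

        identify-before : ∀ z → before z (identify z) ≡ true
        identify-before z with z == b in eq
        ... | true = subst (λ w → before w a ≡ true) (sym (==⇒≡ eq)) (Eqv.sy E⁺ a~b)
        ... | false = Eqv.rf E⁺ z

        walk⇒after-merged : ∀ {u v k} → Walk h X⁺ u v k → merge after a b u v ≡ true
        walk⇒after-merged wnil = Eqv.rf merged _
        walk⇒after-merged {u} (wcons {x = x} (f , l , p) w) = Eqv.tr merged (step⇒merged p) (walk⇒after-merged w)
          where
            step⇒merged : (h f ≡ (u , x) ⊎ h f ≡ (x , u)) → merge after a b u x ≡ true
            step⇒merged p with f ≟F e
            step⇒merged (inj₁ q) | yes refl =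
              merge-i1 after a b (subst (λ z → after u z ≡ true) (sym (cong proj₁ q)) (Eqv.rf E⁻ u))
                                 (subst (λ z → after z x ≡ true) (sym (cong proj₂ q)) (Eqv.rf E⁻ x))
            step⇒merged (inj₂ q) | yes refl =
              merge-i2 after a b (subst (λ z → after u z ≡ true) (sym (cong proj₂ q)) (Eqv.rf E⁻ u))
                                 (subst (λ z → after z x ≡ true) (sym (cong proj₁ q)) (Eqv.rf E⁻ x))
            step⇒merged p | no ne =
              Eqv.tr merged (identify-merged u) (Eqv.tr merged (merge-⊇ after a b (image p)) (Eqv.sy merged (identify-merged x)))
              where
                f∈X⁻ : lookup X⁻ f ≡ true
                f∈X⁻ = trans (upd-other X false ne) (trans (sym (upd-other X true ne)) l)
                image : (h f ≡ (u , x) ⊎ h f ≡ (x , u)) → after (identify u) (identify x) ≡ true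
                image (inj₁ q) = walk⇒conn contracted
                  (wcons (f , f∈X⁻ , inj₁ (cong (λ pr → (identify (proj₁ pr) , identify (proj₂ pr))) q)) wnil)
                image (inj₂ q) = walk⇒conn contracted
                  (wcons (f , f∈X⁻ , inj₂ (cong (λ pr → (identify (proj₁ pr) , identify (proj₂ pr))) q)) wnil)

        after-walk⇒before : ∀ {u v k} → Walk contracted X⁻ u v k → before u v ≡ true
        after-walk⇒before wnil = Eqv.rf E⁺ _
        after-walk⇒before {u} (wcons {x = x} (f , l , p) w) = Eqv.tr E⁺ (step⇒before p) (after-walk⇒before w)
          where
            f≢e : ¬ (f ≡ e)
            f≢e refl = t≢f l (upd-same X e false)
            f-before : before (proj₁ (h f)) (proj₂ (h f)) ≡ true
            f-before = edge-conn (f , trans (upd-other X true f≢e) (trans (sym (upd-other X false f≢e)) l) , inj₁ refl)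
            image-before : before (identify (proj₁ (h f))) (identify (proj₂ (h f))) ≡ true
            image-before = Eqv.tr E⁺ (Eqv.sy E⁺ (identify-before _)) (Eqv.tr E⁺ f-before (identify-before _))
            step⇒before : (contracted f ≡ (u , x) ⊎ contracted f ≡ (x , u)) → before u x ≡ true
            step⇒before (inj₁ q) = subst₂ (λ s t → before s t ≡ true) (cong proj₁ q) (cong proj₂ q) image-before
            step⇒before (inj₂ q) = Eqv.sy E⁺ (subst₂ (λ s t → before s t ≡ true) (cong proj₁ q) (cong proj₂ q) image-before)

        before≡merged-after : ∀ u v → before u v ≡ merge after a b u v
        before≡merged-after u v = bool-ext (λ p → walk⇒after-merged (proj₂ (conn⇒walk h p))) from
          where
            after⇒before : ∀ {u v} → after u v ≡ true → before u v ≡ true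
            after⇒before p = after-walk⇒before (proj₂ (conn⇒walk contracted p))
            from : merge after a b u v ≡ true → before u v ≡ true
            from p with merge-e after a b p
            ... | inj₁ q = after⇒before q
            ... | inj₂ (inj₁ (q , r)) = Eqv.tr E⁺ (after⇒before q) (Eqv.tr E⁺ a~b (after⇒before r))
            ... | inj₂ (inj₂ (q , r)) = Eqv.tr E⁺ (after⇒before q) (Eqv.tr E⁺ (Eqv.sy E⁺ a~b) (after⇒before r))

        b-isolated : ∀ {v k} → Walk contracted X⁻ b v k → v ≡ b
        b-isolated wnil = refl
        b-isolated (wcons (f , l , inj₁ q) w) = ⊥-elim (identify≢b (proj₁ (h f)) (cong proj₁ q))
        b-isolated (wcons (f , l , inj₂ q) w) = ⊥-elim (identify≢b (proj₂ (h f)) (cong proj₂ q))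

        a≁b-after : after a b ≡ false
        a≁b-after = ¬t⇒f λ p → a≢b (b-isolated (proj₂ (conn⇒walk contracted (Eqv.sy E⁻ p))))

        comps-contracted : comps contracted X⁻ ≡ suc (comps h X⁺)
        comps-contracted =
          sym (trans (cong suc (cnt-ext {R = before} {R' = merge after a b} before≡merged-after)) (cnt-merge E⁻ a b a≁b-after))

  card-upd-f : ∀ {m} (X : Subset m) e → lookup X e ≡ true → suc (card (X [ e ]≔ false)) ≡ card X
  card-upd-f (true v∷ X) fzero p = refl
  card-upd-f (x v∷ X) (fsuc e) p with x
  ... | true = cong suc (card-upd-f X e p)
  ... | false = card-upd-f X e p

  card-upd-t : ∀ {m} (X : Subset m) e → lookup X e ≡ false → card (X [ e ]≔ true) ≡ suc (card X)
  card-upd-t (false v∷ X) fzero p = refl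
  card-upd-t (x v∷ X) (fsuc e) p with x
  ... | true = cong suc (card-upd-t X e p)
  ... | false = card-upd-t X e p

  card-0 : ∀ {m} (X : Subset m) → card X ≡ 0 → ∀ f → lookup X f ≡ false
  card-0 (false v∷ X) p fzero = refl
  card-0 (false v∷ X) p (fsuc f) = card-0 X p f
  card-0 (true v∷ X) () f

  card-pos : ∀ {m} (X : Subset m) {k} → card X ≡ suc k → Σ (Fin m) λ e → lookup X e ≡ true
  card-pos (true v∷ X) p = fzero , refl
  card-pos (false v∷ X) p with card-pos X p
  ... | e , q = fsuc e , q

  module RankBound {n m : ℕ} (h : Fin m → Fin n × Fin n) where
    open OnEnds h

    -- each edge lowers the number of components by at most one
    bound-card : ∀ k (X : Subset m) → card X ≡ k → n ≤ comps h X + k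
    bound-card zero X c0 = ℕP.≤-reflexive (trans (sym (comps-empty (card-0 X c0))) (sym (ℕP.+-identityʳ _)))
    bound-card (suc k) X ck with card-pos X ck
    ... | e , e∈X = ≤-trans (bound-card k X⁻ card-X⁻) one-edge
      where
        X⁻ : Subset m
        X⁻ = X [ e ]≔ false
        card-X⁻ : card X⁻ ≡ k
        card-X⁻ = ℕP.suc-injective (trans (card-upd-f X e e∈X) ck)
        at-most-one : comps h X⁻ ≤ suc (comps h X)
        at-most-one = subst (λ Z → comps h X⁻ ≤ suc (comps h Z)) (upd-restore X e e∈X) (AtEdge.add-≤ e X⁻)
        one-edge : comps h X⁻ + k ≤ comps h X + suc k
        one-edge = subst (comps h X⁻ + k ≤_) (sym (ℕP.+-suc (comps h X) k)) (ℕP.+-monoˡ-≤ k at-most-one)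

    bound : ∀ (X : Subset m) → n ≤ comps h X + card X
    bound X = bound-card (card X) X refl


module EdgeStatistics where

  open import Data.Bool using (true; false; _∧_)
  open import Data.Bool.Properties using (∧-zeroʳ)
  open import Data.Nat using (ℕ; suc; _+_; _∸_; _≤_; _<_)
  open import Data.Nat.Properties as ℕP using (n∸n≡0; +-identityʳ; +-suc; +-∸-assoc)
  open import Data.Fin using (Fin) renaming (zero to fzero; suc to fsuc)
  open import Data.Fin.Subset using (Subset; _∩_)
  open import Data.Vec using (lookup; _[_]≔_) renaming ([] to v[]; _∷_ to _v∷_)
  open import Data.Vec.Properties using (lookup-zipWith)
  open import Data.Product using (_×_)
  open import Relation.Binary.PropositionalEquality
  open import Relation.Nullary using (¬_)
  open import Defs using (comps; card; conn)
  open BoolFacts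
  open Representatives using (Eqv)
  open Walks using (conn-eqv)
  open Components

  ∩-lookup : ∀ {k} (S P : Subset k) f → lookup (S ∩ P) f ≡ lookup S f ∧ lookup P f
  ∩-lookup S P f = lookup-zipWith _∧_ f S P

  ∩-⊆ : ∀ {k} (S P : Subset k) → (S ∩ P) ⊆s P
  ∩-⊆ S P f l = ∧-r {lookup S f} (trans (sym (∩-lookup S P f)) l)

  ∩-update-false : ∀ {k} (S P : Subset k) e → (S [ e ]≔ false) ∩ P ≡ S ∩ (P [ e ]≔ false)
  ∩-update-false (s v∷ S) (p v∷ P) fzero with s | p
  ... | true | true = refl
  ... | true | false = refl
  ... | false | true = refl
  ... | false | false = refl
  ∩-update-false (s v∷ S) (p v∷ P) (fsuc e) = cong ((s ∧ p) v∷_) (∩-update-false S P e)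

  ∩-update-true : ∀ {k} (S P : Subset k) e → lookup P e ≡ true →
    (S [ e ]≔ true) ∩ P ≡ (S ∩ (P [ e ]≔ false)) [ e ]≔ true
  ∩-update-true (s v∷ S) (true v∷ P) fzero refl = refl
  ∩-update-true (s v∷ S) (p v∷ P) (fsuc e) q = cong ((s ∧ p) v∷_) (∩-update-true S P e q)

  ∩-removed : ∀ {k} (S P : Subset k) e → lookup (S ∩ (P [ e ]≔ false)) e ≡ false
  ∩-removed (s v∷ S) (p v∷ P) fzero = ∧-zeroʳ s
  ∩-removed (s v∷ S) (p v∷ P) (fsuc e) = ∩-removed S P e

  card-empty : ∀ {k} (X : Subset k) → (∀ f → lookup X f ≡ false) → card X ≡ 0
  card-empty v[] _ = refl
  card-empty (true v∷ X) z with z fzero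
  ... | ()
  card-empty (false v∷ X) z = card-empty X (λ f → z (fsuc f))

  ∸-suc-split : ∀ {a b} → suc b ≤ a → a ∸ b ≡ suc (a ∸ suc b)
  ∸-suc-split {suc a} le = +-∸-assoc 1 (ℕP.≤-pred le)

  nullity : ∀ {n m} → (Fin m → Fin n × Fin n) → Subset m → ℕ
  nullity {n} h X = (comps h X + card X) ∸ n

  corankIn : ∀ {n m} → (Fin m → Fin n × Fin n) → Subset m → Subset m → ℕ
  corankIn h P S = comps h (S ∩ P) ∸ comps h P

  nullityIn : ∀ {n m} → (Fin m → Fin n × Fin n) → Subset m → Subset m → ℕ
  nullityIn h P S = nullity h (S ∩ P)

  module NoEdges {n m} (h : Fin m → Fin n × Fin n) {P : Subset m} (none : ∀ f → lookup P f ≡ false) where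
    open OnEnds h using (comps-empty)

    private
      none∩ : ∀ S f → lookup (S ∩ P) f ≡ false
      none∩ S f = trans (∩-lookup S P f) (trans (cong (lookup S f ∧_) (none f)) (∧-zeroʳ (lookup S f)))

    corank-empty : ∀ S → corankIn h P S ≡ 0
    corank-empty S = trans (cong₂ _∸_ (comps-empty (none∩ S)) (comps-empty none)) (n∸n≡0 n)

    nullity-empty : ∀ S → nullityIn h P S ≡ 0
    nullity-empty S =
      trans (cong (_∸ n) (trans (cong₂ _+_ (comps-empty (none∩ S)) (card-empty (S ∩ P) (none∩ S))) (+-identityʳ n)))
            (n∸n≡0 n)

  module SingleEdge {n m} (h : Fin m → Fin n × Fin n) (e : Fin m) where
    open OnEnds.AtEdge h e using (a; b; contracted; add-joined)

    comps-add-loop : a ≡ b → ∀ X → comps h (X [ e ]≔ true) ≡ comps h X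
    comps-add-loop ab X = add-joined X (subst (λ z → conn h X a z ≡ true) ab (Eqv.rf (conn-eqv h X) a))

    nullity-add-loop : a ≡ b → ∀ X → lookup X e ≡ false → nullity h (X [ e ]≔ true) ≡ suc (nullity h X)
    nullity-add-loop ab X xe = begin
        (comps h (X [ e ]≔ true) + card (X [ e ]≔ true)) ∸ n
      ≡⟨ cong₂ (λ c k → (c + k) ∸ n) (comps-add-loop ab X) (card-upd-t X e xe) ⟩
        (comps h X + suc (card X)) ∸ n
      ≡⟨ cong (_∸ n) (+-suc (comps h X) (card X)) ⟩
        suc (comps h X + card X) ∸ n
      ≡⟨ +-∸-assoc 1 (RankBound.bound h X) ⟩
        suc (nullity h X) ∎
      where open ≡-Reasoning

    -- contracting a non-loop e leaves X + e with one component fewer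
    -- (the contracted endpoint becomes isolated) and the same nullity
    comps-contract : ¬ (a ≡ b) → ∀ X → lookup X e ≡ false → comps contracted X ≡ suc (comps h (X [ e ]≔ true))
    comps-contract ab X xe = trans (cong (comps contracted) (sym (upd-noop X e xe))) (OnEnds.AtEdge.Contraction.comps-contracted h e ab X)

    nullity-contract : ¬ (a ≡ b) → ∀ X → lookup X e ≡ false → nullity h (X [ e ]≔ true) ≡ nullity contracted X
    nullity-contract ab X xe = cong (_∸ n) (begin
        comps h (X [ e ]≔ true) + card (X [ e ]≔ true)
      ≡⟨ cong (comps h (X [ e ]≔ true) +_) (card-upd-t X e xe) ⟩
        comps h (X [ e ]≔ true) + suc (card X)
      ≡⟨ +-suc _ (card X) ⟩
        suc (comps h (X [ e ]≔ true)) + card X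
      ≡⟨ cong (_+ card X) (sym (comps-contract ab X xe)) ⟩
        comps contracted X + card X ∎)
      where open ≡-Reasoning

  module EdgeStep {n m} (h : Fin m → Fin n × Fin n) (P : Subset m) (e : Fin m) (pe : lookup P e ≡ true) where
    open OnEnds h using (comps-anti; conn-mono)
    open OnEnds.AtEdge h e using (a; b; contracted; add-joined; add-separating)
    open SingleEdge h e

    P⁻ : Subset m
    P⁻ = P [ e ]≔ false

    private
      X : Subset m → Subset m
      X S = S ∩ P⁻

      restore : P⁻ [ e ]≔ true ≡ P
      restore = upd-restore P e pe

    nullity-deleted : ∀ S → nullityIn h P (S [ e ]≔ false) ≡ nullityIn h P⁻ S
    nullity-deleted S = cong (nullity h) (∩-update-false S P e)

    corank-deleted : comps h P ≡ comps h P⁻ → ∀ S → corankIn h P (S [ e ]≔ false) ≡ corankIn h P⁻ S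
    corank-deleted same S = cong₂ _∸_ (cong (comps h) (∩-update-false S P e)) same

    module Loop (ab : a ≡ b) where
      comps-P : comps h P ≡ comps h P⁻
      comps-P = trans (cong (comps h) (sym restore)) (comps-add-loop ab P⁻)

      corank-added : ∀ S → corankIn h P (S [ e ]≔ true) ≡ corankIn h P⁻ S
      corank-added S =
        cong₂ _∸_ (trans (cong (comps h) (∩-update-true S P e pe)) (comps-add-loop ab (X S))) comps-P

      nullity-added : ∀ S → nullityIn h P (S [ e ]≔ true) ≡ suc (nullityIn h P⁻ S)
      nullity-added S =
        trans (cong (nullity h) (∩-update-true S P e pe)) (nullity-add-loop ab (X S) (∩-removed S P e))

    module NonLoop (ab : ¬ (a ≡ b)) where
      comps-P : comps contracted P⁻ ≡ suc (comps h P)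
      comps-P = trans (OnEnds.AtEdge.Contraction.comps-contracted h e ab P) (cong (λ Z → suc (comps h Z)) (upd-noop P e pe))

      corank-added : ∀ S → corankIn h P (S [ e ]≔ true) ≡ corankIn contracted P⁻ S
      corank-added S =
        trans (cong (λ Z → comps h Z ∸ comps h P) (∩-update-true S P e pe))
              (sym (cong₂ _∸_ (comps-contract ab (X S) (∩-removed S P e)) comps-P))

      nullity-added : ∀ S → nullityIn h P (S [ e ]≔ true) ≡ nullityIn contracted P⁻ S
      nullity-added S =
        trans (cong (nullity h) (∩-update-true S P e pe)) (nullity-contract ab (X S) (∩-removed S P e))

      module Isthmus (lt : comps h P < comps h P⁻) where
        -- e joins two components of every S ∩ (P - e), as it does for P - e
        separated : ∀ S → conn h (X S) a b ≡ false
        separated S = ¬t⇒f λ p →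
          ℕP.<-irrefl (trans (cong (comps h) (sym restore)) (add-joined P⁻ (conn-mono (∩-⊆ S P⁻) p))) lt

        comps-deleted : ∀ S → comps contracted (X S) ≡ comps h (X S)
        comps-deleted S = trans (comps-contract ab (X S) (∩-removed S P e)) (add-separating (X S) (separated S))

        corank-deleted-isthmus : ∀ S → corankIn h P (S [ e ]≔ false) ≡ suc (corankIn contracted P⁻ S)
        corank-deleted-isthmus S = begin
            comps h ((S [ e ]≔ false) ∩ P) ∸ comps h P
          ≡⟨ cong (λ Z → comps h Z ∸ comps h P) (∩-update-false S P e) ⟩
            comps h (X S) ∸ comps h P
          ≡⟨ cong (_∸ comps h P) (sym (comps-deleted S)) ⟩
            comps contracted (X S) ∸ comps h P
          ≡⟨ ∸-suc-split (subst (_≤ comps contracted (X S)) comps-P (OnEnds.comps-anti contracted (∩-⊆ S P⁻))) ⟩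
            suc (comps contracted (X S) ∸ suc (comps h P))
          ≡⟨ cong (λ k → suc (comps contracted (X S) ∸ k)) (sym comps-P) ⟩
            suc (corankIn contracted P⁻ S) ∎
          where open ≡-Reasoning

        nullity-deleted-isthmus : ∀ S → nullityIn h P (S [ e ]≔ false) ≡ nullityIn contracted P⁻ S
        nullity-deleted-isthmus S =
          trans (nullity-deleted S) (cong (λ c → (c + card (X S)) ∸ n) (sym (comps-deleted S)))

    standard-comps : ¬ (comps h P < comps h P⁻) → comps h P ≡ comps h P⁻
    standard-comps ¬lt = ℕP.≤-antisym (comps-anti (removed-⊆ P e)) (ℕP.≮⇒≥ ¬lt)

-- The key identity ΣS-halve splits a subset sum by membership of one
-- element: each subset S is counted as S + e and as S - e, with weight ½.

module SubsetSums where

  open import Data.Bool using (Bool; true; false; if_then_else_)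
  open import Data.Nat using (suc)
  open import Data.Fin using (Fin) renaming (zero to fzero; suc to fsuc)
  open import Data.Fin.Subset using (Subset)
  open import Data.Vec using (_[_]≔_) renaming ([] to v[]; _∷_ to _v∷_)
  open import Data.List using (List; []; _∷_; _++_; map; filterᵇ)
  open import Data.List.Membership.Propositional using (_∈_)
  open import Data.List.Membership.Propositional.Properties using (∈-map⁺; ∈-map⁻; ∈-++⁺ˡ; ∈-++⁺ʳ)
  open import Data.List.Relation.Unary.Any using (here)
  open import Data.List.Relation.Unary.All using ([])
  open import Data.List.Relation.Unary.Unique.Propositional using (Unique; []; _∷_)
  open import Data.List.Relation.Unary.Unique.Propositional.Properties using (++⁺; map⁺)
  open import Data.List.Relation.Binary.Permutation.Propositional as ↭ using (_↭_)
  open import Data.Product using (_×_; _,_)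
  open import Data.Rational using (ℚ; 0ℚ; ½) renaming (_+_ to _+q_; _*_ to _*q_)
  open import Data.Rational.Properties using (+-identityˡ; +-identityʳ; *-zeroʳ; *-distribˡ-+; +-assoc)
  open import Data.Rational.Solver using (module +-*-Solver)
  open +-*-Solver
  open import Relation.Binary.PropositionalEquality
  open import Relation.Nullary using (¬_)
  open import Defs using (allSubsets; Σℚ)

  Σ-cong : ∀ {A : Set} (xs : List A) {f g : A → ℚ} → (∀ a → f a ≡ g a) → Σℚ xs f ≡ Σℚ xs g
  Σ-cong [] h = refl
  Σ-cong (x ∷ xs) h = cong₂ _+q_ (h x) (Σ-cong xs h)

  Σ-++ : ∀ {A : Set} (xs ys : List A) (f : A → ℚ) → Σℚ (xs ++ ys) f ≡ Σℚ xs f +q Σℚ ys f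
  Σ-++ [] ys f = sym (+-identityˡ _)
  Σ-++ (x ∷ xs) ys f = trans (cong (f x +q_) (Σ-++ xs ys f)) (sym (+-assoc (f x) _ _))

  Σ-map : ∀ {A B : Set} (g : A → B) (xs : List A) (f : B → ℚ) → Σℚ (map g xs) f ≡ Σℚ xs (λ a → f (g a))
  Σ-map g [] f = refl
  Σ-map g (x ∷ xs) f = cong (f (g x) +q_) (Σ-map g xs f)

  Σ-mul : ∀ {A : Set} (xs : List A) (c : ℚ) (f : A → ℚ) → Σℚ xs (λ a → c *q f a) ≡ c *q Σℚ xs f
  Σ-mul [] c f = sym (*-zeroʳ c)
  Σ-mul (x ∷ xs) c f = trans (cong (c *q f x +q_) (Σ-mul xs c f)) (sym (*-distribˡ-+ c (f x) _))

  Σ-add : ∀ {A : Set} (xs : List A) (f g : A → ℚ) → Σℚ xs (λ a → f a +q g a) ≡ Σℚ xs f +q Σℚ xs g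
  Σ-add [] f g = sym (+-identityʳ 0ℚ)
  Σ-add (x ∷ xs) f g = trans (cong (f x +q g x +q_) (Σ-add xs f g))
    (solve 4 (λ a b c d → (a :+ b) :+ (c :+ d) := (a :+ c) :+ (b :+ d)) refl (f x) (g x) (Σℚ xs f) (Σℚ xs g))

  Σ-filter : ∀ {A : Set} (p : A → Bool) (xs : List A) (f : A → ℚ) →
    Σℚ (filterᵇ p xs) f ≡ Σℚ xs (λ a → if p a then f a else 0ℚ)
  Σ-filter p [] f = refl
  Σ-filter p (x ∷ xs) f with p x
  ... | true = cong (f x +q_) (Σ-filter p xs f)
  ... | false = trans (Σ-filter p xs f) (sym (+-identityˡ _))

  Σ-↭ : ∀ {A : Set} {xs ys : List A} (f : A → ℚ) → xs ↭ ys → Σℚ xs f ≡ Σℚ ys f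
  Σ-↭ f ↭.refl = refl
  Σ-↭ f (↭.prep x p) = cong (f x +q_) (Σ-↭ f p)
  Σ-↭ f (↭.swap x y p) =
    trans (cong (λ s → f x +q (f y +q s)) (Σ-↭ f p))
          (solve 3 (λ a b c → a :+ (b :+ c) := b :+ (a :+ c)) refl (f x) (f y) _)
  Σ-↭ f (↭.trans p q) = trans (Σ-↭ f p) (Σ-↭ f q)

  allSubsets-complete : ∀ {k} (S : Subset k) → S ∈ allSubsets k
  allSubsets-complete v[] = here refl
  allSubsets-complete {suc k} (true v∷ S) = ∈-++⁺ˡ (∈-map⁺ (true v∷_) (allSubsets-complete S))
  allSubsets-complete {suc k} (false v∷ S) =
    ∈-++⁺ʳ (map (true v∷_) (allSubsets k)) (∈-map⁺ (false v∷_) (allSubsets-complete S))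

  allSubsets-unique : ∀ k → Unique (allSubsets k)
  allSubsets-unique 0 = [] ∷ []
  allSubsets-unique (suc k) = ++⁺ (map⁺ tail-inj (allSubsets-unique k)) (map⁺ tail-inj (allSubsets-unique k)) disjoint
    where
      tail-inj : ∀ {b} {S S' : Subset k} → (b v∷ S) ≡ (b v∷ S') → S ≡ S'
      tail-inj refl = refl
      disjoint : ∀ {v} → ¬ (v ∈ map (true v∷_) (allSubsets k) × v ∈ map (false v∷_) (allSubsets k))
      disjoint (m₁ , m₂) with ∈-map⁻ (true v∷_) m₁ | ∈-map⁻ (false v∷_) m₂
      ... | _ , _ , refl | _ , _ , ()

  ΣS : ∀ {k} → (Subset k → ℚ) → ℚ
  ΣS {k} f = Σℚ (allSubsets k) f

  ΣS-suc : ∀ {k} (f : Subset (suc k) → ℚ) → ΣS f ≡ ΣS (λ S → f (true v∷ S)) +q ΣS (λ S → f (false v∷ S))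
  ΣS-suc {k} f = trans (Σ-++ (map (true v∷_) (allSubsets k)) _ f)
    (cong₂ _+q_ (Σ-map (true v∷_) (allSubsets k) f) (Σ-map (false v∷_) (allSubsets k) f))

  ΣS-halve : ∀ {k} (e : Fin k) (f : Subset k → ℚ) →
    ΣS f ≡ ½ *q ΣS (λ S → f (S [ e ]≔ true) +q f (S [ e ]≔ false))
  ΣS-halve {suc k} fzero f = begin
      ΣS f
    ≡⟨ ΣS-suc f ⟩
      A +q B
    ≡⟨ solve 2 (λ A B → A :+ B := con ½ :* ((A :+ B) :+ (A :+ B))) refl A B ⟩
      ½ *q ((A +q B) +q (A +q B))
    ≡⟨ cong (λ s → ½ *q (s +q s)) (sym (Σ-add (allSubsets k) (λ S → f (true v∷ S)) (λ S → f (false v∷ S)))) ⟩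
      ½ *q (ΣS both +q ΣS both)
    ≡⟨ cong (½ *q_) (sym (ΣS-suc (λ S → f (S [ fzero ]≔ true) +q f (S [ fzero ]≔ false)))) ⟩
      ½ *q ΣS (λ S → f (S [ fzero ]≔ true) +q f (S [ fzero ]≔ false)) ∎
    where
      open ≡-Reasoning
      A B : ℚ
      A = ΣS (λ S → f (true v∷ S))
      B = ΣS (λ S → f (false v∷ S))
      both : Subset k → ℚ
      both S = f (true v∷ S) +q f (false v∷ S)
  ΣS-halve {suc k} (fsuc e) f = begin
      ΣS f
    ≡⟨ ΣS-suc f ⟩
      ΣS (λ S → f (true v∷ S)) +q ΣS (λ S → f (false v∷ S))
    ≡⟨ cong₂ _+q_ (ΣS-halve e (λ S → f (true v∷ S))) (ΣS-halve e (λ S → f (false v∷ S))) ⟩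
      ½ *q ΣS (split true) +q ½ *q ΣS (split false)
    ≡⟨ sym (*-distribˡ-+ ½ (ΣS (split true)) (ΣS (split false))) ⟩
      ½ *q (ΣS (split true) +q ΣS (split false))
    ≡⟨ cong (½ *q_) (sym (ΣS-suc (λ S → f (S [ fsuc e ]≔ true) +q f (S [ fsuc e ]≔ false)))) ⟩
      ½ *q ΣS (λ S → f (S [ fsuc e ]≔ true) +q f (S [ fsuc e ]≔ false)) ∎
    where
      open ≡-Reasoning
      split : Bool → Subset k → ℚ
      split b S = f (b v∷ (S [ e ]≔ true)) +q f (b v∷ (S [ e ]≔ false))

-- A tree is valid for an
-- edge set P when along every path it decides each edge of P exactly
-- once; the tree of a decision tree Δ is valid for E(G), and the run on a
-- valid tree only looks at S ∩ P.

module DecisionTrees (G : Graph) where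

  open import Data.Bool using (true; false; if_then_else_)
  open import Data.Fin using (Fin)
  open import Data.Fin.Properties using () renaming (_≟_ to _≟F_)
  open import Data.Fin.Subset using (Subset; ⊤)
  open import Data.Vec using (lookup; _[_]≔_)
  open import Data.Vec.Properties using (lookup-replicate)
  open import Data.List using (List; []; _∷_; _++_; allFin)
  open import Data.List.Membership.Propositional using (_∈_)
  open import Data.List.Membership.Propositional.Properties using (∈-allFin; ∈-map⁺; ∈-++⁺ˡ)
  open import Data.List.Relation.Unary.Any using (here; there)
  open import Data.List.Relation.Unary.All as All using (All; []; _∷_)
  open import Data.List.Relation.Unary.All.Properties using (map⁻; ++⁻ˡ; ++⁻ʳ)
  open import Data.List.Relation.Unary.Unique.Propositional using (Unique; _∷_)
  open import Data.List.Relation.Unary.Unique.Propositional.Properties using (allFin⁺)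
  open import Data.List.Relation.Binary.Permutation.Propositional using (_↭_; ↭-sym; ↭⇒↭ₛ)
  open import Data.List.Relation.Binary.Permutation.Propositional.Properties using (∈-resp-↭)
  import Data.List.Relation.Binary.Permutation.Setoid.Properties as SetoidPermutation
  open import Data.Product using (Σ; _×_; _,_; proj₁; proj₂)
  open import Data.Empty using (⊥-elim)
  open import Relation.Binary.PropositionalEquality
  open import Relation.Nullary using (¬_; yes; no)
  open BoolFacts
  open Components using (upd-same; upd-other)

  Ends : Set
  Ends = Fin (m G) → Fin (n G) × Fin (n G)

  data DTree : Set where
    stop : DTree
    branch : Fin (m G) → DTree → DTree → DTree

  mutual
    runD : DTree → Minor G → Subset (m G) → List EType
    runD stop H S = []
    runD (branch e l r) H S = descend (classify H S e) e l r H S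

    descend : EType → Fin (m G) → DTree → DTree → Minor G → Subset (m G) → List EType
    descend Se e l r H S = Se ∷ runD l (delete H e) S
    descend L e l r H S = L ∷ runD l (delete H e) S
    descend Si e l r H S = Si ∷ runD r (contract H e) S
    descend I e l r H S = I ∷ runD r (contract H e) S

  fromPTree : ∀ {k} → PTree (Fin (m G)) k → DTree
  fromPTree (leaf e) = branch e stop stop
  fromPTree (node e l r) = branch e (fromPTree l) (fromPTree r)

  run-fromPTree : ∀ {k} (t : PTree (Fin (m G)) k) H S → run t H S ≡ runD (fromPTree t) H S
  run-fromPTree (leaf e) H S with classify H S e
  ... | Se = refl
  ... | L = refl
  ... | Si = refl
  ... | I = refl
  run-fromPTree (node e l r) H S with classify H S e
  ... | Se = cong (Se ∷_) (run-fromPTree l _ S)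
  ... | L = cong (L ∷_) (run-fromPTree l _ S)
  ... | Si = cong (Si ∷_) (run-fromPTree r _ S)
  ... | I = cong (I ∷_) (run-fromPTree r _ S)

  Valid : DTree → Subset (m G) → Set
  Valid stop P = ∀ f → lookup P f ≡ false
  Valid (branch e l r) P = lookup P e ≡ true × Valid l (P [ e ]≔ false) × Valid r (P [ e ]≔ false)

  Agree : Subset (m G) → Subset (m G) → Subset (m G) → Set
  Agree P S S' = ∀ f → lookup P f ≡ true → lookup S f ≡ lookup S' f

  agree-restrict : ∀ {P S S'} e → Agree P S S' → Agree (P [ e ]≔ false) S S'
  agree-restrict {P} e ag f l with f ≟F e
  ... | yes refl = ⊥-elim (t≢f l (upd-same P e false))
  ... | no ne = ag f (trans (sym (upd-other P false ne)) l)

  agree-update : ∀ P e b S → Agree (P [ e ]≔ false) (S [ e ]≔ b) S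
  agree-update P e b S f l with f ≟F e
  ... | yes refl = ⊥-elim (t≢f l (upd-same P e false))
  ... | no ne = upd-other S b ne

  run-local : ∀ t (h : Ends) P → Valid t P → ∀ {S S'} → Agree P S S' →
    runD t (minor h P) S ≡ runD t (minor h P) S'
  run-local stop h P _ ag = refl
  run-local (branch e l r) h P (pe , vl , vr) {S} {S'} ag =
    trans (cong (λ c → descend c e l r H S) same-type) (continue (classify H S' e))
    where
      H : Minor G
      H = minor h P
      same-type : classify H S e ≡ classify H S' e
      same-type = cong (λ s → if isLoop H e then L else if isIsthmus H e then I else if s then Si else Se) (ag e pe)
      ag⁻ : Agree (P [ e ]≔ false) S S'
      ag⁻ = agree-restrict {P} {S} {S'} e ag
      continue : ∀ c → descend c e l r H S ≡ descend c e l r H S'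
      continue Se = cong (Se ∷_) (run-local l h _ vl ag⁻)
      continue L = cong (L ∷_) (run-local l h _ vl ag⁻)
      continue Si = cong (Si ∷_) (run-local r _ _ vr ag⁻)
      continue I = cong (I ∷_) (run-local r _ _ vr ag⁻)

  module AtBranch (h : Ends) {P : Subset (m G)} {e l r} (valid : Valid (branch e l r) P) where
    private
      H : Minor G
      H = minor h P
      vl : Valid l (P [ e ]≔ false)
      vl = proj₁ (proj₂ valid)
      vr : Valid r (P [ e ]≔ false)
      vr = proj₂ (proj₂ valid)

    run-loop : isLoop H e ≡ true → ∀ b S → runD (branch e l r) H (S [ e ]≔ b) ≡ L ∷ runD l (delete H e) S
    run-loop p b S rewrite p = cong (L ∷_) (run-local l h _ vl (agree-update P e b S))

    run-isthmus : isLoop H e ≡ false → isIsthmus H e ≡ true →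
      ∀ b S → runD (branch e l r) H (S [ e ]≔ b) ≡ I ∷ runD r (contract H e) S
    run-isthmus p q b S rewrite p | q = cong (I ∷_) (run-local r _ _ vr (agree-update P e b S))

    run-contract : isLoop H e ≡ false → isIsthmus H e ≡ false →
      ∀ S → runD (branch e l r) H (S [ e ]≔ true) ≡ Si ∷ runD r (contract H e) S
    run-contract p q S rewrite p | q | upd-same S e true = cong (Si ∷_) (run-local r _ _ vr (agree-update P e true S))

    run-delete : isLoop H e ≡ false → isIsthmus H e ≡ false →
      ∀ S → runD (branch e l r) H (S [ e ]≔ false) ≡ Se ∷ runD l (delete H e) S
    run-delete p q S rewrite p | q | upd-same S e false = cong (Se ∷_) (run-local l h _ vl (agree-update P e false S))

  Covers : Subset (m G) → List (Fin (m G)) → Set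
  Covers P p = Unique p × (∀ f → (f ∈ p → lookup P f ≡ true) × (lookup P f ≡ true → f ∈ p))

  covers-tail : ∀ P a p → Covers P (a ∷ p) → Covers (P [ a ]≔ false) p
  covers-tail P a p ((a∉p ∷ u) , mem) = u , λ f → to f , from f
    where
      to : ∀ f → f ∈ p → lookup (P [ a ]≔ false) f ≡ true
      to f m with f ≟F a
      ... | yes refl = ⊥-elim (All.lookup a∉p m refl)
      ... | no ne = trans (upd-other P false ne) (proj₁ (mem f) (there m))
      from : ∀ f → lookup (P [ a ]≔ false) f ≡ true → f ∈ p
      from f l with f ≟F a
      ... | yes refl = ⊥-elim (t≢f l (upd-same P a false))
      ... | no ne with proj₂ (mem f) (trans (sym (upd-other P false ne)) l)
      ... | here e = ⊥-elim (ne e)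
      ... | there m = m

  some-path : ∀ {k} (t : PTree (Fin (m G)) k) → Σ (List (Fin (m G))) λ p → p ∈ paths t
  some-path (leaf a) = _ , here refl
  some-path (node a l r) with some-path l
  ... | p , m = a ∷ p , ∈-map⁺ (a ∷_) (∈-++⁺ˡ m)

  valid-fromPTree : ∀ {k} (t : PTree (Fin (m G)) k) P → All (Covers P) (paths t) → Valid (fromPTree t) P
  valid-fromPTree (leaf a) P (cov ∷ []) = proj₁ (proj₂ cov a) (here refl) , emptied , emptied
    where
      emptied : ∀ f → lookup (P [ a ]≔ false) f ≡ false
      emptied f with f ≟F a
      ... | yes refl = upd-same P a false
      ... | no ne = trans (upd-other P false ne) (¬t⇒f λ l → not-a (proj₂ (proj₂ cov f) l))
        where
          not-a : ¬ (f ∈ (a ∷ []))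
          not-a (here e) = ne e
  valid-fromPTree (node a l r) P covs =
      a∈P
    , valid-fromPTree l _ (All.map (covers-tail P a _) (++⁻ˡ (paths l) covs'))
    , valid-fromPTree r _ (All.map (covers-tail P a _) (++⁻ʳ (paths l) covs'))
    where
      covs' : All (λ p → Covers P (a ∷ p)) (paths l ++ paths r)
      covs' = map⁻ covs
      a∈P : lookup P a ≡ true
      a∈P with some-path l
      ... | p , m = proj₁ (proj₂ (All.lookup (++⁻ˡ (paths l) covs') m) a) (here refl)

  valid-Δ : (Δ : DecisionTree G) → Valid (fromPTree (DecisionTree.tree Δ)) ⊤
  valid-Δ Δ = valid-fromPTree (DecisionTree.tree Δ) ⊤ (All.map covers-all (DecisionTree.perms Δ))
    where
      covers-all : ∀ {p} → p ↭ allFin (m G) → Covers ⊤ p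
      covers-all σ = SetoidPermutation.Unique-resp-↭ (setoid _) (↭⇒↭ₛ (↭-sym σ)) (allFin⁺ (m G)) ,
        λ f → (λ _ → lookup-replicate f true) , (λ _ → ∈-resp-↭ (↭-sym σ) (∈-allFin f))

-- A cycle makes
-- its first edge redundant, and a redundant edge lies on a cycle (close
-- a shortest walk between its ends); removing edges one at a time shows
-- c(F) + |F| = n when no edge is redundant, and a redundant edge forces
-- c(F) + |F| > n.

module Forests (G : Graph) where

  open import Data.Bool using (true; false; _∧_)
  open import Data.Bool.ListAction using (any)
  open import Data.Nat using (zero; suc; _+_; _∸_; _<_; s≤s)
  open import Data.Nat.Properties as ℕP using ()
  open import Data.Fin using (Fin; toℕ; inject₁; fromℕ) renaming (zero to fzero; suc to fsuc)
  open import Data.Fin.Properties using (toℕ-inject₁; inject₁-injective; fromℕ≢inject₁; suc-injective) renaming (_≟_ to _≟F_)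
  open import Data.Fin.Subset using (Subset) renaming (_∈_ to _∈ₛ_)
  open import Data.Vec using (lookup; _[_]≔_)
  open import Data.Vec.Properties using ([]=⇒lookup; lookup⇒[]=)
  open import Data.List using (allFin)
  open import Data.List.Membership.Propositional.Properties using (∈-allFin)
  open import Data.Product using (_×_; _,_; proj₁; proj₂)
  open import Data.Sum using (inj₁; inj₂)
  open import Data.Empty using (⊥; ⊥-elim)
  open import Function.Bundles using (_⇔_; mk⇔)
  open import Relation.Binary.PropositionalEquality
  open import Relation.Nullary using (¬_; yes; no)
  open BoolFacts
  open Representatives using (Eqv)
  open Walks
  open Components
  open OnEnds (ends G)

  private
    h : Fin (m G) → Fin (n G) × Fin (n G)
    h = ends G

  Redundant : Subset (m G) → Fin (m G) → Set
  Redundant F e = lookup F e ≡ true × conn h (F [ e ]≔ false) (proj₁ (h e)) (proj₂ (h e)) ≡ true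

  -- a redundant edge does not change the components, so c(F) + |F| > n
  redundant⇒excess : ∀ {F e} → Redundant F e → n G < comps h F + card F
  redundant⇒excess {F} {e} (e∈F , joined) =
    subst₂ (λ s t → n G < s + t) same-comps (card-upd-f F e e∈F)
      (subst (n G <_) (sym (ℕP.+-suc (comps h F⁻) (card F⁻))) (s≤s (RankBound.bound h F⁻)))
    where
      F⁻ : Subset (m G)
      F⁻ = F [ e ]≔ false
      same-comps : comps h F⁻ ≡ comps h F
      same-comps = sym (trans (cong (comps h) (sym (upd-restore F e e∈F))) (AtEdge.add-joined e F⁻ joined))

  cycle-walk : ∀ {X} k (vs : Fin (suc k) → Fin (n G)) (es : Fin k → Fin (m G)) →
    (∀ i → lookup X (es i) ≡ true) → (∀ i → Joins G (es i) (vs (inject₁ i)) (vs (fsuc i))) →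
    Walk h X (vs fzero) (vs (fromℕ k)) k
  cycle-walk zero vs es l j = wnil
  cycle-walk (suc k) vs es l j = wcons (es fzero , l fzero , j fzero)
    (cycle-walk k (λ i → vs (fsuc i)) (λ i → es (fsuc i)) (λ i → l (fsuc i)) (λ i → j (fsuc i)))

  -- the rest of a cycle joins the ends of its first edge
  cycle⇒redundant : ∀ {F} (cy : Cycle G F) → Redundant F (Cycle.es cy fzero)
  cycle⇒redundant {F} cy = in-F fzero , ends-joined
    where
      open Cycle cy renaming (es to ces; w to cw)
      e₀ : Fin (m G)
      e₀ = ces fzero
      F⁻ : Subset (m G)
      F⁻ = F [ e₀ ]≔ false
      in-F : ∀ i → lookup F (ces i) ≡ true
      in-F i = []=⇒lookup (es∈S i)
      rest-in-F⁻ : ∀ i → lookup F⁻ (ces (fsuc i)) ≡ true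
      rest-in-F⁻ i = trans (upd-other F false (λ q → suc≢zero (es-inj q))) (in-F (fsuc i))
        where
          suc≢zero : ¬ (fsuc i ≡ fzero)
          suc≢zero ()
      around : conn h F⁻ (cw (fsuc fzero)) (cw fzero) ≡ true
      around = subst (λ z → conn h F⁻ (cw (fsuc fzero)) z ≡ true) (sym closed)
        (walk⇒conn h (cycle-walk len (λ i → cw (fsuc i)) (λ i → ces (fsuc i)) rest-in-F⁻ (λ i → joins (fsuc i))))
      ends-joined : conn h F⁻ (proj₁ (h e₀)) (proj₂ (h e₀)) ≡ true
      ends-joined with joins fzero
      ... | inj₁ q = subst₂ (λ s t → conn h F⁻ s t ≡ true) (sym (cong proj₁ q)) (sym (cong proj₂ q))
                       (Eqv.sy (conn-eqv h F⁻) around)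
      ... | inj₂ q = subst₂ (λ s t → conn h F⁻ s t ≡ true) (sym (cong proj₁ q)) (sym (cong proj₂ q)) around

  no-backtrack : ∀ {k} (i j : Fin k) → inject₁ i ≡ fsuc j → fsuc i ≡ inject₁ j → ⊥
  no-backtrack i j q₁ q₂ =
    ℕP.<-irrefl (sym (trans (cong suc (sym i≡j+1)) i+1≡j)) (ℕP.n≤1+n (suc (toℕ j)))
    where
      i≡j+1 : toℕ i ≡ suc (toℕ j)
      i≡j+1 = trans (sym (toℕ-inject₁ i)) (cong toℕ q₁)
      i+1≡j : suc (toℕ i) ≡ toℕ j
      i+1≡j = trans (cong toℕ q₂) (toℕ-inject₁ j)

  -- a redundant edge closes a vertex-injective walk between its ends into a cycle
  redundant⇒cycle : ∀ {F e} → Redundant F e → Cycle G F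
  redundant⇒cycle {F} {e} (e∈F , joined) with loop-erase h (proj₂ (conn⇒walk h (Eqv.sy (conn-eqv h (F [ e ]≔ false)) joined)))
  ... | k , w , uq = record
      { len = k ; es = es' ; w = w' ; es∈S = es'∈F ; joins = es'-joins ; closed = sym (vs-last h w)
      ; es-inj = es'-inj ; w-inj = w'-inj }
    where
      F⁻ : Subset (m G)
      F⁻ = F [ e ]≔ false
      es' : Fin (suc k) → Fin (m G)
      es' fzero = e
      es' (fsuc i) = es h w i
      w' : Fin (suc (suc k)) → Fin (n G)
      w' fzero = proj₁ (h e)
      w' (fsuc i) = vs h w i
      es'∈F : ∀ i → es' i ∈ₛ F
      es'∈F fzero = lookup⇒[]= e F e∈F
      es'∈F (fsuc i) = lookup⇒[]= _ F (removed-⊆ F e _ (proj₁ (es-step h w i)))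
      es'-joins : ∀ i → Joins G (es' i) (w' (inject₁ i)) (w' (fsuc i))
      es'-joins fzero = inj₁ (cong (proj₁ (h e) ,_) (sym (vs-first h w)))
      es'-joins (fsuc i) = proj₂ (es-step h w i)
      vs-inj' : ∀ {i j} → vs h w i ≡ vs h w j → i ≡ j
      vs-inj' = vs-inj h w uq
      same-ends : ∀ {i j} → es h w i ≡ es h w j → (π : Fin (n G) × Fin (n G) → Fin (n G)) →
        ∀ {s t} → h (es h w i) ≡ s → h (es h w j) ≡ t → π s ≡ π t
      same-ends q π p p' = trans (cong π (sym p)) (trans (cong (λ f → π (h f)) q) (cong π p'))
      walk-es-inj : ∀ {i j} → es h w i ≡ es h w j → i ≡ j
      walk-es-inj {i} {j} q with es-step h w i | es-step h w j
      ... | _ , inj₁ p | _ , inj₁ p' = inject₁-injective (vs-inj' (same-ends q proj₁ p p'))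
      ... | _ , inj₂ p | _ , inj₂ p' = suc-injective (vs-inj' (same-ends q proj₁ p p'))
      ... | _ , inj₁ p | _ , inj₂ p' =
        ⊥-elim (no-backtrack i j (vs-inj' (same-ends q proj₁ p p')) (vs-inj' (same-ends q proj₂ p p')))
      ... | _ , inj₂ p | _ , inj₁ p' =
        ⊥-elim (no-backtrack i j (vs-inj' (same-ends q proj₂ p p')) (vs-inj' (same-ends q proj₁ p p')))
      e∉F⁻ : lookup F⁻ e ≡ false
      e∉F⁻ = upd-same F e false
      es'-inj : ∀ {i j} → es' i ≡ es' j → i ≡ j
      es'-inj {fzero} {fzero} q = refl
      es'-inj {fzero} {fsuc j} q = ⊥-elim (t≢f (subst (λ f → lookup F⁻ f ≡ true) (sym q) (proj₁ (es-step h w j))) e∉F⁻)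
      es'-inj {fsuc i} {fzero} q = ⊥-elim (t≢f (subst (λ f → lookup F⁻ f ≡ true) q (proj₁ (es-step h w i))) e∉F⁻)
      es'-inj {fsuc i} {fsuc j} q = cong fsuc (walk-es-inj q)
      w'-inj : ∀ {i j} → w' (inject₁ i) ≡ w' (inject₁ j) → i ≡ j
      w'-inj {fzero} {fzero} q = refl
      w'-inj {fzero} {fsuc j} q = ⊥-elim (fromℕ≢inject₁ (vs-inj' (trans (vs-last h w) q)))
      w'-inj {fsuc i} {fzero} q = ⊥-elim (fromℕ≢inject₁ (vs-inj' (trans (vs-last h w) (sym q))))
      w'-inj {fsuc i} {fsuc j} q = cong fsuc (inject₁-injective (vs-inj' q))

  -- without redundant edges, every edge joins two components: c(F) + |F| = n
  irredundant⇒rank : ∀ k F → card F ≡ k → (∀ e → ¬ Redundant F e) → comps h F + card F ≡ n G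
  irredundant⇒rank zero F ck _ rewrite ck = trans (ℕP.+-identityʳ _) (comps-empty (card-0 F ck))
  irredundant⇒rank (suc k) F ck irr with card-pos F ck
  ... | e , e∈F = begin
      comps h F + card F
    ≡⟨ cong (comps h F +_) (sym (card-upd-f F e e∈F)) ⟩
      comps h F + suc (card F⁻)
    ≡⟨ ℕP.+-suc (comps h F) (card F⁻) ⟩
      suc (comps h F) + card F⁻
    ≡⟨ cong (_+ card F⁻) one-more ⟩
      comps h F⁻ + card F⁻
    ≡⟨ irredundant⇒rank k F⁻ (ℕP.suc-injective (trans (card-upd-f F e e∈F) ck)) irr⁻ ⟩
      n G ∎
    where
      open ≡-Reasoning
      F⁻ : Subset (m G)
      F⁻ = F [ e ]≔ false
      -- removing edges keeps every remaining edge irredundant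
      shrink : ∀ f → (F⁻ [ f ]≔ false) ⊆s (F [ f ]≔ false)
      shrink f g l with g ≟F f
      ... | yes refl = ⊥-elim (t≢f l (upd-same F⁻ f false))
      ... | no ne = trans (upd-other F false ne) (removed-⊆ F e g (trans (sym (upd-other F⁻ false ne)) l))
      irr⁻ : ∀ f → ¬ Redundant F⁻ f
      irr⁻ f (f∈F⁻ , joined) = irr f (removed-⊆ F e f f∈F⁻ , conn-mono (shrink f) joined)
      separated : conn h F⁻ (proj₁ (h e)) (proj₂ (h e)) ≡ false
      separated = ¬t⇒f λ joined → irr e (e∈F , joined)
      one-more : suc (comps h F) ≡ comps h F⁻
      one-more = trans (cong (λ Z → suc (comps h Z)) (sym (upd-restore F e e∈F))) (AtEdge.add-separating e F⁻ separated)

  acyclic⇒rank : ∀ F → Acyclic G F → comps h F + card F ≡ n G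
  acyclic⇒rank F acyclic with any (λ e → lookup F e ∧ conn h (F [ e ]≔ false) (proj₁ (h e)) (proj₂ (h e))) (allFin (m G)) in found
  ... | true with any-e (allFin (m G)) found
  ... | e , _ , q = ⊥-elim (acyclic (redundant⇒cycle (∧-l q , ∧-r {lookup F e} q)))
  acyclic⇒rank F acyclic | false = irredundant⇒rank (card F) F refl λ e (e∈F , joined) →
    t≢f (any-i (∈-allFin e) (∧-i e∈F joined)) found

  acyclic⇔nullity-zero : ∀ F → Acyclic G F ⇔ β G F ≡ 0
  acyclic⇔nullity-zero F = mk⇔ to from
    where
      to : Acyclic G F → β G F ≡ 0
      to acyclic = trans (cong (_∸ n G) (acyclic⇒rank F acyclic)) (ℕP.n∸n≡0 (n G))
      from : β G F ≡ 0 → Acyclic G F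
      from zero-nullity cy = ℕP.<⇒≱ (redundant⇒excess (cycle⇒redundant cy)) (ℕP.m∸n≡0⇒m≤n zero-nullity)

-- If W is admissible, Φ obeys the
-- deletion/contraction recursion, so all admissible weights give the
-- same Φ on valid trees.

module Expansions (G : Graph) (x y : ℚ) where

  open import Data.Bool using (Bool; true; false; if_then_else_)
  open import Data.Nat using (ℕ; zero; suc; _∸_; _≡ᵇ_)
  open import Data.Fin.Subset using (Subset; ⊤)
  open import Data.Fin.Subset.Properties using (∩-identityʳ)
  open import Data.Vec using (_[_]≔_)
  open import Data.List using (List; []; _∷_; length; filterᵇ)
  open import Data.Product using (proj₁; proj₂)
  open import Data.Rational using (ℚ; 0ℚ; 1ℚ; ½) renaming (_+_ to _+q_; _*_ to _*q_; _-_ to _-q_)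
  open import Data.Rational.Solver using (module +-*-Solver)
  open +-*-Solver
  open import Relation.Binary.PropositionalEquality
  open import Relation.Nullary using ()
  open BoolFacts
  open Components using (module OnEnds)
  open EdgeStatistics
  open SubsetSums
  open DecisionTrees G

  count : (EType → Bool) → List EType → ℕ
  count p ts = length (filterᵇ p ts)

  Weight : Set
  Weight = ℕ → ℕ → List EType → ℚ

  weight-cong : ∀ (W : Weight) {i i' j j' ts ts'} → i ≡ i' → j ≡ j' → ts ≡ ts' → W i j ts ≡ W i' j' ts'
  weight-cong W refl refl refl = refl

  -- the local identities making the subset sum follow the recursion
  record Admissible (W : Weight) : Set where
    field
      unit         : W 0 0 [] ≡ 1ℚ
      loop-rule    : ∀ i j ts → W i (suc j) (L ∷ ts) +q W i j (L ∷ ts) ≡ y *q W i j ts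
      isthmus-rule : ∀ i j ts → W i j (I ∷ ts) +q W (suc i) j (I ∷ ts) ≡ x *q W i j ts
      contract-rule : ∀ i j ts → W i j (Si ∷ ts) ≡ W i j ts
      delete-rule  : ∀ i j ts → W i j (Se ∷ ts) ≡ W i j ts

  term : Weight → DTree → Ends → Subset (m G) → Subset (m G) → ℚ
  term W t h P S = W (corankIn h P S) (nullityIn h P S) (runD t (minor h P) S)

  Φ : Weight → DTree → Ends → Subset (m G) → ℚ
  Φ W t h P = ΣS (term W t h P)

  Φ-stop : ∀ {W} → Admissible W → ∀ h {P} → Valid stop P → Φ W stop h P ≡ ΣS {m G} (λ _ → 1ℚ)
  Φ-stop {W} adm h {P} none = Σ-cong (allSubsets (m G)) λ S →
    trans (weight-cong W (corank-empty S) (nullity-empty S) refl) (Admissible.unit adm)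
    where open NoEdges h {P} none

  module Step {W : Weight} (adm : Admissible W) (h : Ends) {P e l r} (valid : Valid (branch e l r) P) where
    open Admissible adm
    open EdgeStep h P e (proj₁ valid)
    open OnEnds.AtEdge h e using (contracted)
    open AtBranch h valid
    open ≡-Reasoning

    private
      t : DTree
      t = branch e l r
      H : Minor G
      H = minor h P

    split : ΣS (term W t h P) ≡ ½ *q ΣS (λ S → term W t h P (S [ e ]≔ true) +q term W t h P (S [ e ]≔ false))
    split = ΣS-halve e (term W t h P)

    Φ-loop : isLoop H e ≡ true → Φ W t h P ≡ ½ *q (y *q Φ W l h P⁻)
    Φ-loop p = begin
        Φ W t h P
      ≡⟨ split ⟩
        ½ *q ΣS (λ S → term W t h P (S [ e ]≔ true) +q term W t h P (S [ e ]≔ false))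
      ≡⟨ cong (½ *q_) (trans (Σ-cong (allSubsets (m G)) both) (Σ-mul (allSubsets (m G)) y (term W l h P⁻))) ⟩
        ½ *q (y *q Φ W l h P⁻) ∎
      where
        open Loop (==⇒≡ p)
        both : ∀ S → term W t h P (S [ e ]≔ true) +q term W t h P (S [ e ]≔ false) ≡ y *q term W l h P⁻ S
        both S = trans (cong₂ _+q_
            (weight-cong W (corank-added S) (nullity-added S) (run-loop p true S))
            (weight-cong W (corank-deleted comps-P S) (nullity-deleted S) (run-loop p false S)))
          (loop-rule _ _ _)

    Φ-isthmus : isLoop H e ≡ false → isIsthmus H e ≡ true → Φ W t h P ≡ ½ *q (x *q Φ W r contracted P⁻)
    Φ-isthmus p q = begin
        Φ W t h P
      ≡⟨ split ⟩
        ½ *q ΣS (λ S → term W t h P (S [ e ]≔ true) +q term W t h P (S [ e ]≔ false))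
      ≡⟨ cong (½ *q_) (trans (Σ-cong (allSubsets (m G)) both) (Σ-mul (allSubsets (m G)) x (term W r contracted P⁻))) ⟩
        ½ *q (x *q Φ W r contracted P⁻) ∎
      where
        open NonLoop (λ ab → t≢f (≡⇒== ab) p)
        open Isthmus (<ᵇ⇒< q)
        both : ∀ S → term W t h P (S [ e ]≔ true) +q term W t h P (S [ e ]≔ false) ≡ x *q term W r contracted P⁻ S
        both S = trans (cong₂ _+q_
            (weight-cong W (corank-added S) (nullity-added S) (run-isthmus p q true S))
            (weight-cong W (corank-deleted-isthmus S) (nullity-deleted-isthmus S) (run-isthmus p q false S)))
          (isthmus-rule _ _ _)

    Φ-standard : isLoop H e ≡ false → isIsthmus H e ≡ false →
      Φ W t h P ≡ ½ *q (Φ W r contracted P⁻ +q Φ W l h P⁻)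
    Φ-standard p q = begin
        Φ W t h P
      ≡⟨ split ⟩
        ½ *q ΣS (λ S → term W t h P (S [ e ]≔ true) +q term W t h P (S [ e ]≔ false))
      ≡⟨ cong (½ *q_) (trans (Σ-cong (allSubsets (m G)) both)
                             (Σ-add (allSubsets (m G)) (term W r contracted P⁻) (term W l h P⁻))) ⟩
        ½ *q (Φ W r contracted P⁻ +q Φ W l h P⁻) ∎
      where
        open NonLoop (λ ab → t≢f (≡⇒== ab) p)
        both : ∀ S → term W t h P (S [ e ]≔ true) +q term W t h P (S [ e ]≔ false)
                   ≡ term W r contracted P⁻ S +q term W l h P⁻ S
        both S = cong₂ _+q_
          (trans (weight-cong W (corank-added S) (nullity-added S) (run-contract p q S)) (contract-rule _ _ _))
          (trans (weight-cong W (corank-deleted (standard-comps (λ lt → t≢f (<⇒<ᵇ lt) q)) S) (nullity-deleted S)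
                                (run-delete p q S))
                 (delete-rule _ _ _))

  Φ-agree : ∀ {W W'} → Admissible W → Admissible W' → ∀ t h P → Valid t P → Φ W t h P ≡ Φ W' t h P
  Φ-agree a a' stop h P none = trans (Φ-stop a h none) (sym (Φ-stop a' h none))
  Φ-agree {W} {W'} a a' (branch e l r) h P valid =
    by-type (isLoop {G} (minor h P) e) refl (isIsthmus {G} (minor h P) e) refl
    where
      open ≡-Reasoning
      P⁻ : Subset (m G)
      P⁻ = P [ e ]≔ false
      h/e : Ends
      h/e = OnEnds.AtEdge.contracted h e
      ih-l : Φ W l h P⁻ ≡ Φ W' l h P⁻
      ih-l = Φ-agree a a' l h P⁻ (proj₁ (proj₂ valid))
      ih-r : Φ W r h/e P⁻ ≡ Φ W' r h/e P⁻
      ih-r = Φ-agree a a' r h/e P⁻ (proj₂ (proj₂ valid))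
      by-type : ∀ bl → isLoop {G} (minor h P) e ≡ bl → ∀ bi → isIsthmus {G} (minor h P) e ≡ bi →
        Φ W (branch e l r) h P ≡ Φ W' (branch e l r) h P
      by-type true p _ _ = begin
        Φ W (branch e l r) h P             ≡⟨ Step.Φ-loop a h valid p ⟩
        ½ *q (y *q Φ W l h P⁻)             ≡⟨ cong (λ v → ½ *q (y *q v)) ih-l ⟩
        ½ *q (y *q Φ W' l h P⁻)            ≡⟨ sym (Step.Φ-loop a' h valid p) ⟩
        Φ W' (branch e l r) h P            ∎
      by-type false p true q = begin
        Φ W (branch e l r) h P             ≡⟨ Step.Φ-isthmus a h valid p q ⟩
        ½ *q (x *q Φ W r h/e P⁻)           ≡⟨ cong (λ v → ½ *q (x *q v)) ih-r ⟩
        ½ *q (x *q Φ W' r h/e P⁻)          ≡⟨ sym (Step.Φ-isthmus a' h valid p q) ⟩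
        Φ W' (branch e l r) h P            ∎
      by-type false p false q = begin
        Φ W (branch e l r) h P             ≡⟨ Step.Φ-standard a h valid p q ⟩
        ½ *q (Φ W r h/e P⁻ +q Φ W l h P⁻)   ≡⟨ cong₂ (λ u v → ½ *q (u +q v)) ih-r ih-l ⟩
        ½ *q (Φ W' r h/e P⁻ +q Φ W' l h P⁻) ≡⟨ sym (Step.Φ-standard a' h valid p q) ⟩
        Φ W' (branch e l r) h P            ∎

  tutteWeight forestWeight connectedWeight activityWeight : Weight
  tutteWeight i j _ = ((x -q 1ℚ) ^ i) *q ((y -q 1ℚ) ^ j)
  forestWeight i j ts = if j ≡ᵇ 0 then ((x -q 1ℚ) ^ i) *q (y ^ count isL ts) else 0ℚ
  connectedWeight i j ts = if i ≡ᵇ 0 then (x ^ count isI ts) *q ((y -q 1ℚ) ^ j) else 0ℚ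
  activityWeight _ _ ts = ((x *q ½) ^ count isI ts) *q ((y *q ½) ^ count isL ts)

  private
    one : 1ℚ *q 1ℚ ≡ 1ℚ
    one = solve 0 (con 1ℚ :* con 1ℚ := con 1ℚ) refl

    zeros : ∀ z → 0ℚ +q 0ℚ ≡ z *q 0ℚ
    zeros = solve 1 (λ z → con 0ℚ :+ con 0ℚ := z :* con 0ℚ) refl

  tutte-admissible : Admissible tutteWeight
  tutte-admissible = record
    { unit = one
    ; loop-rule = λ i j _ → solve 3 (λ a b y → a :* ((y :- con 1ℚ) :* b) :+ a :* b := y :* (a :* b))
                                    refl ((x -q 1ℚ) ^ i) ((y -q 1ℚ) ^ j) y
    ; isthmus-rule = λ i j _ → solve 3 (λ a b x → a :* b :+ ((x :- con 1ℚ) :* a) :* b := x :* (a :* b))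
                                       refl ((x -q 1ℚ) ^ i) ((y -q 1ℚ) ^ j) x
    ; contract-rule = λ _ _ _ → refl
    ; delete-rule = λ _ _ _ → refl }

  forest-admissible : Admissible forestWeight
  forest-admissible = record
    { unit = one
    ; loop-rule = loop
    ; isthmus-rule = isthmus
    ; contract-rule = λ _ _ _ → refl
    ; delete-rule = λ _ _ _ → refl }
    where
      loop : ∀ i j ts → forestWeight i (suc j) (L ∷ ts) +q forestWeight i j (L ∷ ts) ≡ y *q forestWeight i j ts
      loop i zero ts = solve 3 (λ a b y → con 0ℚ :+ a :* (y :* b) := y :* (a :* b))
                             refl ((x -q 1ℚ) ^ i) (y ^ count isL ts) y
      loop i (suc j) ts = zeros y
      isthmus : ∀ i j ts → forestWeight i j (I ∷ ts) +q forestWeight (suc i) j (I ∷ ts) ≡ x *q forestWeight i j ts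
      isthmus i zero ts = solve 3 (λ a b x → a :* b :+ ((x :- con 1ℚ) :* a) :* b := x :* (a :* b))
                                refl ((x -q 1ℚ) ^ i) (y ^ count isL ts) x
      isthmus i (suc j) ts = zeros x

  connected-admissible : Admissible connectedWeight
  connected-admissible = record
    { unit = one
    ; loop-rule = loop
    ; isthmus-rule = isthmus
    ; contract-rule = λ _ _ _ → refl
    ; delete-rule = λ _ _ _ → refl }
    where
      loop : ∀ i j ts → connectedWeight i (suc j) (L ∷ ts) +q connectedWeight i j (L ∷ ts) ≡ y *q connectedWeight i j ts
      loop zero j ts = solve 3 (λ a b y → a :* ((y :- con 1ℚ) :* b) :+ a :* b := y :* (a :* b))
                             refl (x ^ count isI ts) ((y -q 1ℚ) ^ j) y
      loop (suc i) j ts = zeros y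
      isthmus : ∀ i j ts → connectedWeight i j (I ∷ ts) +q connectedWeight (suc i) j (I ∷ ts) ≡ x *q connectedWeight i j ts
      isthmus zero j ts = solve 3 (λ a b x → (x :* a) :* b :+ con 0ℚ := x :* (a :* b))
                                refl (x ^ count isI ts) ((y -q 1ℚ) ^ j) x
      isthmus (suc i) j ts = zeros x

  activity-admissible : Admissible activityWeight
  activity-admissible = record
    { unit = one
    ; loop-rule = λ _ _ ts → solve 3 (λ a b y → a :* ((y :* con ½) :* b) :+ a :* ((y :* con ½) :* b) := y :* (a :* b))
                                     refl ((x *q ½) ^ count isI ts) ((y *q ½) ^ count isL ts) y
    ; isthmus-rule = λ _ _ ts → solve 3 (λ a b x → ((x :* con ½) :* a) :* b :+ ((x :* con ½) :* a) :* b := x :* (a :* b))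
                                        refl ((x *q ½) ^ count isI ts) ((y *q ½) ^ count isL ts) x
    ; contract-rule = λ _ _ _ → refl
    ; delete-rule = λ _ _ _ → refl }

  module AtRoot (connected : Connected G) (Δ : DecisionTree G) where
    private
      tΔ : DTree
      tΔ = fromPTree (DecisionTree.tree Δ)

    Φ-root : ∀ W → Φ W tΔ (ends G) ⊤ ≡ ΣS (λ S → W (c G S ∸ 1) (β G S) (types Δ S))
    Φ-root W = Σ-cong (allSubsets (m G)) λ S → weight-cong W
      (cong₂ _∸_ (cong (comps (ends G)) (∩-identityʳ S)) connected)
      (cong (nullity (ends G)) (∩-identityʳ S))
      (sym (run-fromPTree (DecisionTree.tree Δ) (initial G) S))

    tutte-expansion : ∀ {W} → Admissible W → Tutte G x y ≡ ΣS (λ S → W (c G S ∸ 1) (β G S) (types Δ S))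
    tutte-expansion {W} adm = begin
        Tutte G x y
      ≡⟨ Σ-cong (allSubsets (m G)) (λ S → cong (λ k → tutteWeight (c G S ∸ k) (β G S) []) connected) ⟩
        ΣS (λ S → tutteWeight (c G S ∸ 1) (β G S) (types Δ S))
      ≡⟨ sym (Φ-root tutteWeight) ⟩
        Φ tutteWeight tΔ (ends G) ⊤
      ≡⟨ Φ-agree tutte-admissible adm tΔ (ends G) ⊤ (valid-Δ Δ) ⟩
        Φ W tΔ (ends G) ⊤
      ≡⟨ Φ-root W ⟩
        ΣS (λ S → W (c G S ∸ 1) (β G S) (types Δ S)) ∎
      where open ≡-Reasoning

-- The forest and connected sums of the proposition as subset sums with
-- an indicator: β(S) = 0 for forests, c(S) - 1 = 0 for connected S.

module IndicatorSums (G : Graph) where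

  open import Data.Bool using (Bool; true; T; if_then_else_)
  open import Data.Nat using (_≤_; _∸_; _≡ᵇ_; s≤s)
  open import Data.Nat.Properties using (≡ᵇ⇒≡; ≡⇒≡ᵇ)
  open import Data.Fin.Subset using (Subset)
  open import Data.Vec.Properties using (lookup-replicate)
  open import Data.List using (List; filterᵇ)
  open import Data.List.Membership.Propositional using (_∈_)
  open import Data.List.Membership.Propositional.Properties using (∈-filter⁺; ∈-filter⁻)
  open import Data.List.Membership.Propositional.Properties.WithK using (unique∧set⇒bag)
  open import Data.List.Relation.Unary.Unique.Propositional using (Unique)
  open import Data.List.Relation.Unary.Unique.Propositional.Properties as Unique using ()
  open import Data.List.Relation.Binary.Permutation.Propositional using (_↭_)
  open import Data.List.Relation.Binary.BagAndSetEquality using (∼bag⇒↭)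
  open import Data.Product using (proj₂)
  open import Data.Rational using (ℚ; 0ℚ)
  open import Function.Bundles using (_⇔_; mk⇔; Equivalence)
  open import Relation.Binary.PropositionalEquality
  open import Relation.Nullary.Decidable using (T?)
  open import Relation.Unary using (Decidable)
  open Components using (module OnEnds)
  open SubsetSums
  open Forests G using (acyclic⇔nullity-zero)

  same-members⇒↭ : ∀ {A : Set} {xs ys : List A} → Unique xs → Unique ys → (∀ a → a ∈ xs ⇔ a ∈ ys) → xs ↭ ys
  same-members⇒↭ ux uy same = ∼bag⇒↭ (unique∧set⇒bag ux uy (λ {a} → same a))

  forest-sum : (forests : List (Subset (m G))) → Unique forests → (∀ F → F ∈ forests ⇔ Acyclic G F) →
    (f : Subset (m G) → ℚ) → Σℚ forests f ≡ ΣS (λ S → if β G S ≡ᵇ 0 then f S else 0ℚ)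
  forest-sum forests unique listing f =
    trans (Σ-↭ f (same-members⇒↭ unique (Unique.filter⁺ isForest? {allSubsets (m G)} (allSubsets-unique (m G))) same))
          (Σ-filter isForest (allSubsets (m G)) f)
    where
      isForest : Subset (m G) → Bool
      isForest S = β G S ≡ᵇ 0
      isForest? : Decidable (λ S → T (isForest S))
      isForest? S = T? (isForest S)
      same : ∀ F → F ∈ forests ⇔ F ∈ filterᵇ isForest (allSubsets (m G))
      same F = mk⇔
        (λ F∈ → ∈-filter⁺ isForest? (allSubsets-complete F)
                  (≡⇒≡ᵇ (β G F) 0 (Equivalence.to (acyclic⇔nullity-zero F) (Equivalence.to (listing F) F∈))))
        (λ F∈ → Equivalence.from (listing F) (Equivalence.from (acyclic⇔nullity-zero F)
                  (≡ᵇ⇒≡ (β G F) 0 (proj₂ (∈-filter⁻ isForest? {xs = allSubsets (m G)} F∈)))))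

  connected-sum : Connected G → (f : Subset (m G) → ℚ) →
    Σℚ (filterᵇ (λ K → c G K ≡ᵇ 1) (allSubsets (m G))) f ≡ ΣS (λ K → if (c G K ∸ 1) ≡ᵇ 0 then f K else 0ℚ)
  connected-sum connected f =
    trans (Σ-filter (λ K → c G K ≡ᵇ 1) (allSubsets (m G)) f)
          (Σ-cong (allSubsets (m G)) λ K → cong (λ b → if b then f K else 0ℚ) (is-one (at-least-one K)))
    where
      -- every spanning subgraph has at least as many components as G
      at-least-one : ∀ K → 1 ≤ c G K
      at-least-one K = subst (_≤ c G K) connected (OnEnds.comps-anti (ends G) (λ f _ → lookup-replicate f true))
      is-one : ∀ {k} → 1 ≤ k → (k ≡ᵇ 1) ≡ ((k ∸ 1) ≡ᵇ 0)
      is-one (s≤s _) = refl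

proposition6p7 : (G : Graph) → 1 ≤ m G → Connected G → (Δ : DecisionTree G)
  → (forests : List (Subset (m G))) → Unique forests
  → (∀ F → (F ∈ₗ forests) ⇔ Acyclic G F)
  → (x y : ℚ)
  → (Tutte G x y ≡ Σℚ forests (λ F → ((x -q 1ℚ) ^ (c G F ∸ 1)) *q (y ^ ℓΔ Δ F)))
  × (Tutte G x y ≡ Σℚ (filterᵇ (λ K → c G K ≡ᵇ 1) (allSubsets (m G)))
                      (λ K → (x ^ iΔ Δ K) *q ((y -q 1ℚ) ^ β G K)))
  × (Tutte G x y ≡ Σℚ (allSubsets (m G))
                      (λ S → ((x *q ½) ^ iΔ Δ S) *q ((y *q ½) ^ ℓΔ Δ S)))
proposition6p7 G _ connected Δ forests unique listing x y =
    trans (tutte-expansion forest-admissible) (sym (forest-sum forests unique listing _))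
  , trans (tutte-expansion connected-admissible) (sym (connected-sum connected _))
  , tutte-expansion activity-admissible
  where
    open import Data.Product using (_,_)
    open import Relation.Binary.PropositionalEquality using (trans; sym)
    open Expansions G x y
    open AtRoot connected Δ
    open IndicatorSums G
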